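{- Let $n\ge 1$ and $k_1,k_2\ge 0$ with $\ell=n-k_1-k_2\ge 0$. Let $C$ be a $\mathbb{Z}_4$-code of length $n$ and type $4^{k_1}2^{k_2}$ which is inequivalent to the trivial extension of any $\mathbb{Z}_4$-code of length $n-1$ and type $4^{k_1}2^{k_2}$. Then there is a $\mathbb{Z}_4$-code $C'$ of length $n$ and type $4^{k_1}2^{k_2}$ with $C\cong C'$ which is generated by a matrix $G(A,B,D)\in\mathcal{V}$ such that the matrix $\begin{pmatrix}B\\2D\end{pmatrix}$ has no zero column.
   Context: $\mathbb{Z}_4=\{0,1,2,3\}$ is the ring of integers modulo $4$; a $\mathbb{Z}_4$-code of length $n$ is a submodule of $\mathbb{Z}_4^n$, and the code generated by a matrix is the $\mathbb{Z}_4$-span of its rows. A code has type $4^{k_1}2^{k_2}$ if it is isomorphic as an abelian group to $\mathbb{Z}_4^{k_1}\times\mathbb{Z}_2^{k_2}$. Two codes are equivalent ($C\cong C'$) if $C'=CP$ for a monomial matrix $P$ with nonzero entries in $\{1,-1\}$. The trivial extension of a code $E$ of length $n-1$ is $\{(e,0)\mid e\in E\}$. Order $\mathbb{Z}_4$ by $0<1<2<3$ and order $\mathbb{Z}_4^m$ lexicographically. $M_{m\times n}(R)$ is the set of $m\times n$ matrices with entries in $R$. For $T\subseteq M_{m\times n}(\mathbb{Z}_4)$, $P_{row}(T)$ is the set of matrices in $T$ whose rows $a_1,\dots,a_m$ satisfy $a_i\le a_j$ for $i\le j$, and $P_{col}(T)$ is the set of matrices in $T$ whose columns $b_1,\dots,b_n$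 satisfy $b_i^T\le b_j^T$ for $i\le j$. For a $k_1\times k_2$ $(0,1)$-matrix $A$, a $k_1\times \ell$ $\mathbb{Z}_4$-matrix $B$ and a $k_2\times\ell$ $(0,1)$-matrix $D$, let $G(A,B,D)=\begin{pmatrix} I_{k_1}&A&B\\ O&2I_{k_2}&2D\end{pmatrix}$. $\mathcal{V}$ is the set of all such $G(A,B,D)$ satisfying: (i) $A\in P_{row}(M_{k_1\times k_2}(\{0,1\}))$; (ii) $B\in\mathcal{B}$, where $\mathcal{B}$ consists of all $k_1\times\ell$ matrices with entries in $\{0,2\}$ together with all $k_1\times\ell$ $\mathbb{Z}_4$-matrices $B$ such that, for the smallest $i$ for which the $i$-th row of $B$ contains an entry not in $\{0,2\}$, that row contains only entries in $\{0,1,2\}$; (iii) $\begin{pmatrix}B\\2D\end{pmatrix}\in P_{col}(M_{(k_1+k_2)\times\ell}(\mathbb{Z}_4))$. -}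

module Defs where

open import Data.Nat using (ℕ; zero; suc; pred; _+_; _*_; _<_)
open import Data.Bool using (Bool; true; false)
open import Data.Fin using (Fin; _≟_) renaming (_≤_ to _≤ᶠ_; _<_ to _<ᶠ_)
open import Data.Vec using (Vec; []; _∷_; lookup; tabulate; replicate; map; zipWith; transpose; _++_)
open import Data.Product using (Σ; ∃; _×_; _,_)
open import Data.Sum using (_⊎_)
open import Data.Unit using (⊤)
open import Relation.Nullary using (¬_; yes; no)
open import Relation.Binary.PropositionalEquality using (_≡_; _≢_)

data ℤ₄ : Set where
  z0 z1 z2 z3 : ℤ₄

toℕ₄ : ℤ₄ → ℕ
toℕ₄ z0 = 0
toℕ₄ z1 = 1
toℕ₄ z2 = 2
toℕ₄ z3 = 3

fromℕ₄ : ℕ → ℤ₄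
fromℕ₄ 0 = z0
fromℕ₄ 1 = z1
fromℕ₄ 2 = z2
fromℕ₄ 3 = z3
fromℕ₄ (suc (suc (suc (suc n)))) = fromℕ₄ n

infixl 6 _+₄_
infixl 7 _*₄_

_+₄_ : ℤ₄ → ℤ₄ → ℤ₄
a +₄ b = fromℕ₄ (toℕ₄ a + toℕ₄ b)

_*₄_ : ℤ₄ → ℤ₄ → ℤ₄
a *₄ b = fromℕ₄ (toℕ₄ a * toℕ₄ b)

_<₄_ : ℤ₄ → ℤ₄ → Set
a <₄ b = toℕ₄ a < toℕ₄ b

data ℤ₂ : Set where
  o0 o1 : ℤ₂

_+₂_ : ℤ₂ → ℤ₂ → ℤ₂
o0 +₂ b = b
o1 +₂ o0 = o1
o1 +₂ o1 = o0

Word : ℕ → Set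
Word n = Vec ℤ₄ n

Matrix : ℕ → ℕ → Set
Matrix m n = Vec (Vec ℤ₄ n) m

_+ᵛ_ : ∀ {n} → Word n → Word n → Word n
_+ᵛ_ = zipWith _+₄_

_·ᵛ_ : ∀ {n} → ℤ₄ → Word n → Word n
c ·ᵛ v = map (c *₄_) v

0ᵛ : ∀ {n} → Word n
0ᵛ = replicate _ z0

_+₂ᵛ_ : ∀ {n} → Vec ℤ₂ n → Vec ℤ₂ n → Vec ℤ₂ n
_+₂ᵛ_ = zipWith _+₂_

vecMat : ∀ {m n} → Word m → Matrix m n → Word n
vecMat [] [] = 0ᵛ
vecMat (c ∷ cs) (r ∷ rs) = (c ·ᵛ r) +ᵛ vecMat cs rs

entry : ∀ {m n} → Matrix m n → Fin m → Fin n → ℤ₄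
entry M i j = lookup (lookup M i) j

idMat : ∀ n → Matrix n n
idMat n = tabulate λ i → tabulate λ j → diag i j
  where
  diag : Fin n → Fin n → ℤ₄
  diag i j with i ≟ j
  ... | yes _ = z1
  ... | no _ = z0

zeroMat : ∀ m n → Matrix m n
zeroMat m n = replicate m (replicate n z0)

scaleMat : ∀ {m n} → ℤ₄ → Matrix m n → Matrix m n
scaleMat c = map (c ·ᵛ_)

_∣∣_ : ∀ {m n p} → Matrix m n → Matrix m p → Matrix m (n + p)
_∣∣_ = zipWith _++_

-- a subset of ℤ₄ⁿ, given by its (decidable) membership function
Code : ℕ → Set
Code n = Word n → Bool

_∈ᶜ_ : ∀ {n} → Word n → Code n → Set
w ∈ᶜ C = C w ≡ true

IsCode : ∀ {n} → Code n → Set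
IsCode {n} C = (0ᵛ ∈ᶜ C)
             × (∀ (u v : Word n) → u ∈ᶜ C → v ∈ᶜ C → (u +ᵛ v) ∈ᶜ C)
             × (∀ (c : ℤ₄) (u : Word n) → u ∈ᶜ C → (c ·ᵛ u) ∈ᶜ C)

-- C has type 4^k₁ 2^k₂: C ≅ ℤ₄^k₁ × ℤ₂^k₂ as abelian groups,
-- i.e. there is an injective additive map ℤ₄^k₁ × ℤ₂^k₂ → ℤ₄ⁿ with image C
HasType : ∀ {n} → Code n → ℕ → ℕ → Set
HasType {n} C k₁ k₂ =
  Σ (Vec ℤ₄ k₁ × Vec ℤ₂ k₂ → Word n) λ φ →
      (∀ x₁ x₂ y₁ y₂ → φ (x₁ +ᵛ y₁ , x₂ +₂ᵛ y₂) ≡ φ (x₁ , x₂) +ᵛ φ (y₁ , y₂))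
    × (∀ x y → φ x ≡ φ y → x ≡ y)
    × (∀ x → φ x ∈ᶜ C)
    × (∀ w → w ∈ᶜ C → ∃ λ x → φ x ≡ w)

GeneratedBy : ∀ {m n} → Code n → Matrix m n → Set
GeneratedBy {m} {n} C G =
  ∀ (w : Word n) → (w ∈ᶜ C → ∃ λ (c : Word m) → w ≡ vecMat c G)
                 × ((∃ λ (c : Word m) → w ≡ vecMat c G) → w ∈ᶜ C)

IsSignedMonomial : ∀ {n} → Matrix n n → Set
IsSignedMonomial {n} P =
    (∀ i → ∃ λ j → entry P i j ≢ z0 × (∀ j' → entry P i j' ≢ z0 → j' ≡ j))
  × (∀ j → ∃ λ i → entry P i j ≢ z0 × (∀ i' → entry P i' j ≢ z0 → i' ≡ i))
  × (∀ i j → entry P i j ≡ z0 ⊎ entry P i j ≡ z1 ⊎ entry P i j ≡ z3)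

Equivalent : ∀ {n} → Code n → Code n → Set
Equivalent {n} C C' =
  Σ (Matrix n n) λ P → IsSignedMonomial P ×
    (∀ (w : Word n) → (w ∈ᶜ C' → ∃ λ v → v ∈ᶜ C × w ≡ vecMat v P)
                    × ((∃ λ v → v ∈ᶜ C × w ≡ vecMat v P) → w ∈ᶜ C'))

-- dropping the last coordinate, and testing it for 0 (used for n ≥ 1)
initᵛ : ∀ {n} → Word n → Word (pred n)
initᵛ [] = []
initᵛ (x ∷ []) = []
initᵛ (x ∷ y ∷ xs) = x ∷ initᵛ (y ∷ xs)

lastIsZero : ∀ {n} → Word n → Bool
lastIsZero [] = true
lastIsZero (z0 ∷ []) = true
lastIsZero (_ ∷ []) = false
lastIsZero (x ∷ y ∷ xs) = lastIsZero (y ∷ xs)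

_∧ᵇ_ : Bool → Bool → Bool
true ∧ᵇ b = b
false ∧ᵇ _ = false

TrivialExtension : ∀ {n} → Code (pred n) → Code n
TrivialExtension E w = lastIsZero w ∧ᵇ E (initᵛ w)

_≤ˡᵉˣ_ : ∀ {m} → Word m → Word m → Set
[] ≤ˡᵉˣ [] = ⊤
(x ∷ xs) ≤ˡᵉˣ (y ∷ ys) = x <₄ y ⊎ (x ≡ y × xs ≤ˡᵉˣ ys)

RowSorted : ∀ {m n} → Matrix m n → Set
RowSorted {m} M = ∀ (i j : Fin m) → i ≤ᶠ j → lookup M i ≤ˡᵉˣ lookup M j

ColSorted : ∀ {m n} → Matrix m n → Set
ColSorted M = RowSorted (transpose M)

EntriesIn01 : ∀ {m n} → Matrix m n → Set
EntriesIn01 M = ∀ i j → entry M i j ≡ z0 ⊎ entry M i j ≡ z1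

In02 : ℤ₄ → Set
In02 a = a ≡ z0 ⊎ a ≡ z2

In012 : ℤ₄ → Set
In012 a = a ≡ z0 ⊎ a ≡ z1 ⊎ a ≡ z2

InℬB : ∀ {k₁ ℓ} → Matrix k₁ ℓ → Set
InℬB {k₁} B =
    (∀ i j → In02 (entry B i j))
  ⊎ (∃ λ (i : Fin k₁) →
        (∀ (i' : Fin k₁) → i' <ᶠ i → ∀ j → In02 (entry B i' j))
      × (∃ λ j → ¬ In02 (entry B i j))
      × (∀ j → In012 (entry B i j)))

stackB2D : ∀ {k₁ k₂ ℓ} → Matrix k₁ ℓ → Matrix k₂ ℓ → Matrix (k₁ + k₂) ℓ
stackB2D B D = B ++ scaleMat z2 D

GMat : ∀ {k₁ k₂ ℓ} → Matrix k₁ k₂ → Matrix k₁ ℓ → Matrix k₂ ℓ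
     → Matrix (k₁ + k₂) (k₁ + k₂ + ℓ)
GMat {k₁} {k₂} A B D =
  ((idMat k₁ ∣∣ A) ∣∣ B) ++ ((zeroMat k₂ k₁ ∣∣ scaleMat z2 (idMat k₂)) ∣∣ scaleMat z2 D)

InV : ∀ {k₁ k₂ ℓ} → Matrix k₁ k₂ → Matrix k₁ ℓ → Matrix k₂ ℓ → Set
InV A B D =
    (EntriesIn01 A × RowSorted A)
  × InℬB B
  × (EntriesIn01 D × ColSorted (stackB2D B D))

NoZeroColumn : ∀ {m n} → Matrix m n → Set
NoZeroColumn {m} {n} M = ∀ (j : Fin n) → lookup (transpose M) j ≢ 0ᵛ

module Submission where

-- Every equivalence used is a signed permutation σ of the coordinates, and
-- C' is the transported code σ C.  The proof has four steps:
--  1. the isomorphism C ≅ ℤ₄^k₁ × ℤ₂^k₂ yields an independent generating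
--     family gs (k₁ words of order 4) and hs (k₂ even words)   [basis];
--  2. Gaussian elimination, with each pivot moved into place by a signed
--     transposition, carries the span of this family onto the code of some
--     G(A,B,D) with A and D (0,1)-matrices                    [standardForm];
--  3. sorting the rows of A, changing signs of columns of B, and sorting the
--     columns of (B ; 2D) achieve the three conditions of 𝒱    [normalise];
--  4. a zero column of (B ; 2D) is a coordinate vanishing on σ C, which would
--     make C equivalent to a trivial extension                [zeroColumn-trivial].

open import Defs
open import Data.Nat as ℕ using (ℕ; zero; suc; pred; _+_; _≤_; s≤s)
import Data.Nat.Properties as ℕ
open import Data.Vec using (Vec; []; _∷_; map; _++_; replicate; lookup; tabulate; head; tail; transpose; _⊛_; _∷ʳ_)
open import Data.Vec.Relation.Unary.All using (All; []; _∷_)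
import Data.Vec.Relation.Unary.All as All
open import Data.Vec.Relation.Unary.All.Properties using (lookup⁺; lookup⁻; map⁺; ++ˡ⁻; ++ʳ⁻)
open import Data.Vec.Properties using (map-++; lookup-⊛; map-∘; map-cong; lookup∘tabulate; tabulate∘lookup; tabulate-cong; lookup-map; lookup-zipWith; lookup-replicate; zipWith-assoc; zipWith-comm; zipWith-identityˡ; zipWith-identityʳ; lookup-++ˡ; lookup-++ʳ)
open import Data.Fin using (Fin; zero; suc; fromℕ; splitAt; join; _↑ˡ_; _↑ʳ_) renaming (_≟_ to _≟ᶠ_; _≤_ to _≤ᶠ_; _<_ to _<ᶠ_)
open import Data.Fin.Properties using (splitAt-↑ˡ; splitAt-↑ʳ; join-splitAt)
open import Data.Fin.Permutation using (Permutation′; _⟨$⟩ʳ_; _⟨$⟩ˡ_; inverseˡ; inverseʳ; permutation)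
import Data.Fin.Permutation as P
import Data.Fin.Permutation.Components as PC
import Data.Sum as Sum
open import Data.Product using (Σ; ∃; _×_; _,_; proj₁; proj₂)
open import Data.Sum using (_⊎_; inj₁; inj₂)
open import Relation.Nullary using (Dec; yes; no; does; ¬_)
open import Data.Bool using (true; if_then_else_)
open import Data.Empty using (⊥-elim)
open import Data.Unit using (tt)
open import Relation.Binary using (tri<; tri≈; tri>)
open import Algebra.Bundles using (CommutativeMonoid)
import Algebra.Properties.CommutativeMonoid.Sum as MonoidSum
open import Relation.Nullary.Decidable using (map′; True; toWitness; dec-true)
open import Relation.Binary.PropositionalEquality
open import Function using (_∋_)

private variable
  k m n : ℕ

-- Identities in ℤ₄ are decided by evaluating both sides at all points.

fromℕ₄∘toℕ₄ : ∀ a → fromℕ₄ (toℕ₄ a) ≡ a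
fromℕ₄∘toℕ₄ z0 = refl
fromℕ₄∘toℕ₄ z1 = refl
fromℕ₄∘toℕ₄ z2 = refl
fromℕ₄∘toℕ₄ z3 = refl

toℕ₄-injective : ∀ {a b} → toℕ₄ a ≡ toℕ₄ b → a ≡ b
toℕ₄-injective {a} {b} e = trans (sym (fromℕ₄∘toℕ₄ a)) (trans (cong fromℕ₄ e) (fromℕ₄∘toℕ₄ b))

infix 4 _≟₄_
_≟₄_ : (a b : ℤ₄) → Dec (a ≡ b)
a ≟₄ b = map′ toℕ₄-injective (cong toℕ₄) (toℕ₄ a ℕ.≟ toℕ₄ b)

all₄? : {P : ℤ₄ → Set} → (∀ a → Dec (P a)) → Dec (∀ a → P a)
all₄? P? with P? z0 | P? z1 | P? z2 | P? z3
... | yes p0 | yes p1 | yes p2 | yes p3 = yes λ { z0 → p0 ; z1 → p1 ; z2 → p2 ; z3 → p3 }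
... | no ¬p | _     | _     | _     = no λ h → ¬p (h z0)
... | yes _ | no ¬p | _     | _     = no λ h → ¬p (h z1)
... | yes _ | yes _ | no ¬p | _     = no λ h → ¬p (h z2)
... | yes _ | yes _ | yes _ | no ¬p = no λ h → ¬p (h z3)

-- An identity in one, two or three variables, proved by evaluation (the
-- implicit argument is the trivial proof that the check succeeds).
decide₁ : (f g : ℤ₄ → ℤ₄) → {True (all₄? λ a → f a ≟₄ g a)} → ∀ a → f a ≡ g a
decide₁ f g {ok} = toWitness ok

decide₂ : (f g : ℤ₄ → ℤ₄ → ℤ₄) →
  {True (all₄? λ a → all₄? λ b → f a b ≟₄ g a b)} → ∀ a b → f a b ≡ g a b
decide₂ f g {ok} = toWitness ok

decide₃ : (f g : ℤ₄ → ℤ₄ → ℤ₄ → ℤ₄) →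
  {True (all₄? λ a → all₄? λ b → all₄? λ c → f a b c ≟₄ g a b c)} → ∀ a b c → f a b c ≡ g a b c
decide₃ f g {ok} = toWitness ok

+₄-identityˡ : ∀ a → z0 +₄ a ≡ a
+₄-identityˡ = decide₁ (z0 +₄_) (λ a → a)

+₄-identityʳ : ∀ a → a +₄ z0 ≡ a
+₄-identityʳ = decide₁ (_+₄ z0) (λ a → a)

+₄-comm : ∀ a b → a +₄ b ≡ b +₄ a
+₄-comm = decide₂ _+₄_ (λ a b → b +₄ a)

+₄-assoc : ∀ a b c → (a +₄ b) +₄ c ≡ a +₄ (b +₄ c)
+₄-assoc = decide₃ (λ a b c → (a +₄ b) +₄ c) (λ a b c → a +₄ (b +₄ c))

-- 3 = -1, so a + 3a = 0
+₄-inverseʳ : ∀ a → a +₄ z3 *₄ a ≡ z0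
+₄-inverseʳ = decide₁ (λ a → a +₄ z3 *₄ a) (λ _ → z0)

*₄-comm : ∀ a b → a *₄ b ≡ b *₄ a
*₄-comm = decide₂ _*₄_ (λ a b → b *₄ a)

*₄-assoc : ∀ a b c → (a *₄ b) *₄ c ≡ a *₄ (b *₄ c)
*₄-assoc = decide₃ (λ a b c → (a *₄ b) *₄ c) (λ a b c → a *₄ (b *₄ c))

*₄-identityˡ : ∀ a → z1 *₄ a ≡ a
*₄-identityˡ = decide₁ (z1 *₄_) (λ a → a)

*₄-zeroˡ : ∀ a → z0 *₄ a ≡ z0
*₄-zeroˡ = decide₁ (z0 *₄_) (λ _ → z0)

*₄-zeroʳ : ∀ a → a *₄ z0 ≡ z0
*₄-zeroʳ = decide₁ (_*₄ z0) (λ _ → z0)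

*₄-distribˡ : ∀ a b c → a *₄ (b +₄ c) ≡ a *₄ b +₄ a *₄ c
*₄-distribˡ = decide₃ (λ a b c → a *₄ (b +₄ c)) (λ a b c → a *₄ b +₄ a *₄ c)

*₄-distribʳ : ∀ a b c → (a +₄ b) *₄ c ≡ a *₄ c +₄ b *₄ c
*₄-distribʳ = decide₃ (λ a b c → (a +₄ b) *₄ c) (λ a b c → a *₄ c +₄ b *₄ c)

lookup-+ᵛ : (u v : Word n) (j : Fin n) → lookup (u +ᵛ v) j ≡ lookup u j +₄ lookup v j
lookup-+ᵛ u v j = lookup-zipWith _+₄_ j u v

lookup-·ᵛ : (c : ℤ₄) (u : Word n) (j : Fin n) → lookup (c ·ᵛ u) j ≡ c *₄ lookup u j
lookup-·ᵛ c u j = lookup-map j (c *₄_) u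

lookup-0ᵛ : (j : Fin n) → lookup (0ᵛ {n}) j ≡ z0
lookup-0ᵛ j = lookup-replicate j z0

vext : {A : Set} {u v : Vec A n} → (∀ j → lookup u j ≡ lookup v j) → u ≡ v
vext {u = u} {v} p = trans (sym (tabulate∘lookup u)) (trans (tabulate-cong p) (tabulate∘lookup v))

+ᵛ-identityˡ : (u : Word n) → 0ᵛ +ᵛ u ≡ u
+ᵛ-identityˡ = zipWith-identityˡ +₄-identityˡ

+ᵛ-identityʳ : (u : Word n) → u +ᵛ 0ᵛ ≡ u
+ᵛ-identityʳ = zipWith-identityʳ +₄-identityʳ

+ᵛ-comm : (u v : Word n) → u +ᵛ v ≡ v +ᵛ u
+ᵛ-comm = zipWith-comm +₄-comm

+ᵛ-assoc : (u v w : Word n) → (u +ᵛ v) +ᵛ w ≡ u +ᵛ (v +ᵛ w)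
+ᵛ-assoc = zipWith-assoc +₄-assoc

0ᵛ+ᵛ0ᵛ : 0ᵛ +ᵛ 0ᵛ ≡ 0ᵛ {n}
0ᵛ+ᵛ0ᵛ = +ᵛ-identityˡ 0ᵛ

+ᵛ-inverseʳ : (u : Word n) → u +ᵛ (z3 ·ᵛ u) ≡ 0ᵛ
+ᵛ-inverseʳ [] = refl
+ᵛ-inverseʳ (x ∷ u) = cong₂ _∷_ (+₄-inverseʳ x) (+ᵛ-inverseʳ u)

·ᵛ-distribˡ : (c : ℤ₄) (u v : Word n) → c ·ᵛ (u +ᵛ v) ≡ (c ·ᵛ u) +ᵛ (c ·ᵛ v)
·ᵛ-distribˡ c [] [] = refl
·ᵛ-distribˡ c (x ∷ u) (y ∷ v) = cong₂ _∷_ (*₄-distribˡ c x y) (·ᵛ-distribˡ c u v)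

·ᵛ-distribʳ : (a b : ℤ₄) (u : Word n) → (a +₄ b) ·ᵛ u ≡ (a ·ᵛ u) +ᵛ (b ·ᵛ u)
·ᵛ-distribʳ a b [] = refl
·ᵛ-distribʳ a b (x ∷ u) = cong₂ _∷_ (*₄-distribʳ a b x) (·ᵛ-distribʳ a b u)

·ᵛ-assoc : (a b : ℤ₄) (u : Word n) → (a *₄ b) ·ᵛ u ≡ a ·ᵛ (b ·ᵛ u)
·ᵛ-assoc a b [] = refl
·ᵛ-assoc a b (x ∷ u) = cong₂ _∷_ (*₄-assoc a b x) (·ᵛ-assoc a b u)

·ᵛ-identity : (u : Word n) → z1 ·ᵛ u ≡ u
·ᵛ-identity [] = refl
·ᵛ-identity (x ∷ u) = cong₂ _∷_ (*₄-identityˡ x) (·ᵛ-identity u)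

·ᵛ-zeroˡ : (u : Word n) → z0 ·ᵛ u ≡ 0ᵛ
·ᵛ-zeroˡ [] = refl
·ᵛ-zeroˡ (x ∷ u) = cong₂ _∷_ (*₄-zeroˡ x) (·ᵛ-zeroˡ u)

·ᵛ-zeroʳ : (c : ℤ₄) → c ·ᵛ 0ᵛ {n} ≡ 0ᵛ
·ᵛ-zeroʳ {zero} c = refl
·ᵛ-zeroʳ {suc n} c = cong₂ _∷_ (*₄-zeroʳ c) (·ᵛ-zeroʳ c)

+ᵛ-interchange : (u v w x : Word n) → (u +ᵛ v) +ᵛ (w +ᵛ x) ≡ (u +ᵛ w) +ᵛ (v +ᵛ x)
+ᵛ-interchange u v w x = begin
  (u +ᵛ v) +ᵛ (w +ᵛ x) ≡⟨ +ᵛ-assoc u v (w +ᵛ x) ⟩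
  u +ᵛ (v +ᵛ (w +ᵛ x)) ≡⟨ cong (u +ᵛ_) (sym (+ᵛ-assoc v w x)) ⟩
  u +ᵛ ((v +ᵛ w) +ᵛ x) ≡⟨ cong (λ t → u +ᵛ (t +ᵛ x)) (+ᵛ-comm v w) ⟩
  u +ᵛ ((w +ᵛ v) +ᵛ x) ≡⟨ cong (u +ᵛ_) (+ᵛ-assoc w v x) ⟩
  u +ᵛ (w +ᵛ (v +ᵛ x)) ≡⟨ sym (+ᵛ-assoc u w (v +ᵛ x)) ⟩
  (u +ᵛ w) +ᵛ (v +ᵛ x) ∎
  where open ≡-Reasoning

−+-cancel : (u v : Word n) → (u +ᵛ (z3 ·ᵛ v)) +ᵛ v ≡ u
−+-cancel u v = trans (+ᵛ-assoc u _ v) (trans (cong (u +ᵛ_) (trans (+ᵛ-comm _ v) (+ᵛ-inverseʳ v))) (+ᵛ-identityʳ u))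

double-zero : (u : Word n) → u ≡ u +ᵛ u → u ≡ 0ᵛ
double-zero u eq = begin
  u                              ≡⟨ sym (+ᵛ-identityʳ u) ⟩
  u +ᵛ 0ᵛ                        ≡⟨ cong (u +ᵛ_) (sym (+ᵛ-inverseʳ u)) ⟩
  u +ᵛ (u +ᵛ (z3 ·ᵛ u))          ≡⟨ sym (+ᵛ-assoc u u _) ⟩
  (u +ᵛ u) +ᵛ (z3 ·ᵛ u)          ≡⟨ cong (_+ᵛ (z3 ·ᵛ u)) (sym eq) ⟩
  u +ᵛ (z3 ·ᵛ u)                 ≡⟨ +ᵛ-inverseʳ u ⟩
  0ᵛ                             ∎
  where open ≡-Reasoning

++-+ᵛ : (u u' : Word m) (v v' : Word n) → (u ++ v) +ᵛ (u' ++ v') ≡ (u +ᵛ u') ++ (v +ᵛ v')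
++-+ᵛ [] [] v v' = refl
++-+ᵛ (x ∷ u) (y ∷ u') v v' = cong ((x +₄ y) ∷_) (++-+ᵛ u u' v v')

++-·ᵛ : (c : ℤ₄) (u : Word m) (v : Word n) → c ·ᵛ (u ++ v) ≡ (c ·ᵛ u) ++ (c ·ᵛ v)
++-·ᵛ c [] v = refl
++-·ᵛ c (x ∷ u) v = cong (c *₄ x ∷_) (++-·ᵛ c u v)

++-0ᵛ : 0ᵛ {m + n} ≡ 0ᵛ {m} ++ 0ᵛ {n}
++-0ᵛ {zero} = refl
++-0ᵛ {suc m} = cong (z0 ∷_) (++-0ᵛ {m})

++-0ᵛ⁻¹ : (u : Word m) (v : Word n) → u ++ v ≡ 0ᵛ → u ≡ 0ᵛ × v ≡ 0ᵛ
++-0ᵛ⁻¹ [] v e = refl , e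
++-0ᵛ⁻¹ (x ∷ u) v e = let (e₁ , e₂) = ++-0ᵛ⁻¹ u v (cong tail e) in cong₂ _∷_ (cong head e) e₁ , e₂

vecMat-zeroˡ : (M : Matrix k n) → vecMat 0ᵛ M ≡ 0ᵛ
vecMat-zeroˡ [] = refl
vecMat-zeroˡ (r ∷ M) = trans (cong₂ _+ᵛ_ (·ᵛ-zeroˡ r) (vecMat-zeroˡ M)) 0ᵛ+ᵛ0ᵛ

vecMat-+ : (c d : Word k) (M : Matrix k n) → vecMat (c +ᵛ d) M ≡ vecMat c M +ᵛ vecMat d M
vecMat-+ [] [] [] = sym 0ᵛ+ᵛ0ᵛ
vecMat-+ (a ∷ c) (b ∷ d) (r ∷ M) =
  trans (cong₂ _+ᵛ_ (·ᵛ-distribʳ a b r) (vecMat-+ c d M)) (+ᵛ-interchange _ _ _ _)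

vecMat-· : (a : ℤ₄) (c : Word k) (M : Matrix k n) → vecMat (a ·ᵛ c) M ≡ a ·ᵛ vecMat c M
vecMat-· a [] [] = sym (·ᵛ-zeroʳ a)
vecMat-· a (b ∷ c) (r ∷ M) =
  trans (cong₂ _+ᵛ_ (·ᵛ-assoc a b r) (vecMat-· a c M)) (sym (·ᵛ-distribˡ a _ _))

vecMat-++ : (x : Word k) (y : Word m) (M : Matrix k n) (N : Matrix m n) →
  vecMat (x ++ y) (M ++ N) ≡ vecMat x M +ᵛ vecMat y N
vecMat-++ [] y [] N = sym (+ᵛ-identityˡ _)
vecMat-++ (a ∷ x) y (r ∷ M) N = trans (cong ((a ·ᵛ r) +ᵛ_) (vecMat-++ x y M N)) (sym (+ᵛ-assoc _ _ _))

vecMat-linear : ∀ {n'} (f : Word n → Word n') →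
  (∀ u v → f (u +ᵛ v) ≡ f u +ᵛ f v) → (∀ c u → f (c ·ᵛ u) ≡ c ·ᵛ f u) → f 0ᵛ ≡ 0ᵛ →
  (c : Word k) (M : Matrix k n) → f (vecMat c M) ≡ vecMat c (map f M)
vecMat-linear f f+ f· f0 [] [] = f0
vecMat-linear f f+ f· f0 (a ∷ c) (r ∷ M) =
  trans (f+ _ _) (cong₂ _+ᵛ_ (f· a r) (vecMat-linear f f+ f· f0 c M))

dot : Word k → Word k → ℤ₄
dot [] [] = z0
dot (a ∷ c) (b ∷ v) = a *₄ b +₄ dot c v

column : Matrix k n → Fin n → Word k
column M j = map (λ r → lookup r j) M

lookup-vecMat : (c : Word k) (M : Matrix k n) (j : Fin n) → lookup (vecMat c M) j ≡ dot c (column M j)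
lookup-vecMat [] [] j = lookup-0ᵛ j
lookup-vecMat (a ∷ c) (r ∷ M) j =
  trans (lookup-+ᵛ (a ·ᵛ r) (vecMat c M) j) (cong₂ _+₄_ (lookup-·ᵛ a r j) (lookup-vecMat c M j))

dot-zeroʳ : (v : Word n) → dot v 0ᵛ ≡ z0
dot-zeroʳ [] = refl
dot-zeroʳ (a ∷ v) = cong₂ _+₄_ (*₄-zeroʳ a) (dot-zeroʳ v)

dot-zeroˡ : (u : Word n) → dot 0ᵛ u ≡ z0
dot-zeroˡ [] = refl
dot-zeroˡ (b ∷ u) = cong₂ _+₄_ (*₄-zeroˡ b) (dot-zeroˡ u)

dot-++ : (x : Word k) (z : Word m) (u : Word k) (v : Word m) → dot (x ++ z) (u ++ v) ≡ dot x u +₄ dot z v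
dot-++ [] z [] v = sym (+₄-identityˡ _)
dot-++ (a ∷ x) z (b ∷ u) v = trans (cong (a *₄ b +₄_) (dot-++ x z u v)) (sym (+₄-assoc (a *₄ b) (dot x u) (dot z v)))

-- The units of ℤ₄ are ±1 = {1, 3}; a signed
-- permutation σ = (π, s) acts on words by (σ w)ⱼ = sⱼ · w_{π j}.  It is the
-- action of the signed monomial matrix PM σ, and everything we do to
-- generator matrices (column permutations, sign changes) is such an action.

Unit : ℤ₄ → Set
Unit a = a ≡ z1 ⊎ a ≡ z3

unit-involutive : ∀ {a} → Unit a → ∀ b → a *₄ (a *₄ b) ≡ b
unit-involutive (inj₁ refl) = decide₁ (λ b → z1 *₄ (z1 *₄ b)) (λ b → b)
unit-involutive (inj₂ refl) = decide₁ (λ b → z3 *₄ (z3 *₄ b)) (λ b → b)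

unit-* : ∀ {a b} → Unit a → Unit b → Unit (a *₄ b)
unit-* (inj₁ refl) (inj₁ refl) = inj₁ refl
unit-* (inj₁ refl) (inj₂ refl) = inj₂ refl
unit-* (inj₂ refl) (inj₁ refl) = inj₂ refl
unit-* (inj₂ refl) (inj₂ refl) = inj₁ refl

record SignedPerm (n : ℕ) : Set where
  constructor mkSignedPerm
  field
    π : Permutation′ n
    s : Fin n → ℤ₄
    s-unit : ∀ j → Unit (s j)
open SignedPerm public

-- act is only used through lookup-act; keeping it opaque keeps terms small
opaque
  act : SignedPerm n → Word n → Word n
  act σ w = tabulate (λ j → s σ j *₄ lookup w (π σ ⟨$⟩ʳ j))

  lookup-act : (σ : SignedPerm n) (w : Word n) (j : Fin n) → lookup (act σ w) j ≡ s σ j *₄ lookup w (π σ ⟨$⟩ʳ j)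
  lookup-act σ w j = lookup∘tabulate _ j

act-+ : (σ : SignedPerm n) (u v : Word n) → act σ (u +ᵛ v) ≡ act σ u +ᵛ act σ v
act-+ σ u v = vext λ j → begin
  lookup (act σ (u +ᵛ v)) j                 ≡⟨ lookup-act σ (u +ᵛ v) j ⟩
  s σ j *₄ lookup (u +ᵛ v) (π σ ⟨$⟩ʳ j)     ≡⟨ cong (s σ j *₄_) (lookup-+ᵛ u v _) ⟩
  s σ j *₄ (lookup u _ +₄ lookup v _)       ≡⟨ *₄-distribˡ (s σ j) _ _ ⟩
  s σ j *₄ lookup u _ +₄ s σ j *₄ lookup v _ ≡⟨ sym (cong₂ _+₄_ (lookup-act σ u j) (lookup-act σ v j)) ⟩
  lookup (act σ u) j +₄ lookup (act σ v) j  ≡⟨ sym (lookup-+ᵛ (act σ u) (act σ v) j) ⟩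
  lookup (act σ u +ᵛ act σ v) j             ∎
  where open ≡-Reasoning

act-· : (σ : SignedPerm n) (c : ℤ₄) (u : Word n) → act σ (c ·ᵛ u) ≡ c ·ᵛ act σ u
act-· σ c u = vext λ j → begin
  lookup (act σ (c ·ᵛ u)) j               ≡⟨ lookup-act σ (c ·ᵛ u) j ⟩
  s σ j *₄ lookup (c ·ᵛ u) (π σ ⟨$⟩ʳ j)   ≡⟨ cong (s σ j *₄_) (lookup-·ᵛ c u _) ⟩
  s σ j *₄ (c *₄ lookup u _)              ≡⟨ left-commute (s σ j) c _ ⟩
  c *₄ (s σ j *₄ lookup u _)              ≡⟨ cong (c *₄_) (sym (lookup-act σ u j)) ⟩
  c *₄ lookup (act σ u) j                 ≡⟨ sym (lookup-·ᵛ c (act σ u) j) ⟩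
  lookup (c ·ᵛ act σ u) j                 ∎
  where
  open ≡-Reasoning
  left-commute : ∀ a b x → a *₄ (b *₄ x) ≡ b *₄ (a *₄ x)
  left-commute = decide₃ (λ a b x → a *₄ (b *₄ x)) (λ a b x → b *₄ (a *₄ x))

act-0ᵛ : (σ : SignedPerm n) → act σ 0ᵛ ≡ 0ᵛ
act-0ᵛ σ = vext λ j → trans (lookup-act σ 0ᵛ j)
  (trans (cong (s σ j *₄_) (lookup-0ᵛ (π σ ⟨$⟩ʳ j))) (trans (*₄-zeroʳ (s σ j)) (sym (lookup-0ᵛ j))))

act-vecMat : (σ : SignedPerm n) (c : Word k) (M : Matrix k n) → act σ (vecMat c M) ≡ vecMat c (map (act σ) M)
act-vecMat σ = vecMat-linear (act σ) (act-+ σ) (act-· σ) (act-0ᵛ σ)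

-- the group structure: inverse, composition (first σ₁, then σ₂), identity
inv : SignedPerm n → SignedPerm n
inv σ = mkSignedPerm (P.flip (π σ)) (λ i → s σ (π σ ⟨$⟩ˡ i)) (λ i → s-unit σ _)

act-inv-act : (σ : SignedPerm n) (w : Word n) → act (inv σ) (act σ w) ≡ w
act-inv-act σ w = vext pointwise
  where
  open ≡-Reasoning
  pointwise : ∀ i → lookup (act (inv σ) (act σ w)) i ≡ lookup w i
  pointwise i = begin
    lookup (act (inv σ) (act σ w)) i                       ≡⟨ lookup-act (inv σ) (act σ w) i ⟩
    s σ i' *₄ lookup (act σ w) i'                          ≡⟨ cong (s σ i' *₄_) (lookup-act σ w i') ⟩
    s σ i' *₄ (s σ i' *₄ lookup w (π σ ⟨$⟩ʳ i'))           ≡⟨ unit-involutive (s-unit σ i') _ ⟩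
    lookup w (π σ ⟨$⟩ʳ i')                                 ≡⟨ cong (lookup w) (inverseʳ (π σ)) ⟩
    lookup w i                                             ∎
    where i' = π σ ⟨$⟩ˡ i

act-act-inv : (σ : SignedPerm n) (w : Word n) → act σ (act (inv σ) w) ≡ w
act-act-inv σ w = vext λ j → begin
  lookup (act σ (act (inv σ) w)) j                                 ≡⟨ lookup-act σ _ j ⟩
  s σ j *₄ lookup (act (inv σ) w) (π σ ⟨$⟩ʳ j)                     ≡⟨ cong (s σ j *₄_) (lookup-act (inv σ) w _) ⟩
  s σ j *₄ (s σ (π σ ⟨$⟩ˡ (π σ ⟨$⟩ʳ j)) *₄ lookup w (π σ ⟨$⟩ˡ (π σ ⟨$⟩ʳ j)))
                                                                   ≡⟨ cong (λ t → s σ j *₄ (s σ t *₄ lookup w t)) (inverseˡ (π σ)) ⟩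
  s σ j *₄ (s σ j *₄ lookup w j)                                   ≡⟨ unit-involutive (s-unit σ j) _ ⟩
  lookup w j                                                       ∎
  where open ≡-Reasoning

inv-unique : (σ : SignedPerm n) {v w : Word n} → act σ v ≡ w → act (inv σ) w ≡ v
inv-unique σ {v} eq = trans (cong (act (inv σ)) (sym eq)) (act-inv-act σ v)

_⨾_ : SignedPerm n → SignedPerm n → SignedPerm n
σ₁ ⨾ σ₂ = mkSignedPerm (π σ₂ P.∘ₚ π σ₁) (λ j → s σ₂ j *₄ s σ₁ (π σ₂ ⟨$⟩ʳ j))
  (λ j → unit-* (s-unit σ₂ j) (s-unit σ₁ (π σ₂ ⟨$⟩ʳ j)))

act-⨾ : (σ₁ σ₂ : SignedPerm n) (w : Word n) → act (σ₁ ⨾ σ₂) w ≡ act σ₂ (act σ₁ w)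
act-⨾ σ₁ σ₂ w = vext pointwise
  where
  open ≡-Reasoning
  pointwise : ∀ j → lookup (act (σ₁ ⨾ σ₂) w) j ≡ lookup (act σ₂ (act σ₁ w)) j
  pointwise j = begin
    lookup (act (σ₁ ⨾ σ₂) w) j                           ≡⟨ lookup-act (σ₁ ⨾ σ₂) w j ⟩
    (s σ₂ j *₄ s σ₁ j') *₄ lookup w (π σ₁ ⟨$⟩ʳ j')       ≡⟨ *₄-assoc (s σ₂ j) (s σ₁ j') _ ⟩
    s σ₂ j *₄ (s σ₁ j' *₄ lookup w (π σ₁ ⟨$⟩ʳ j'))       ≡⟨ cong (s σ₂ j *₄_) (sym (lookup-act σ₁ w j')) ⟩
    s σ₂ j *₄ lookup (act σ₁ w) j'                       ≡⟨ sym (lookup-act σ₂ (act σ₁ w) j) ⟩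
    lookup (act σ₂ (act σ₁ w)) j                         ∎
    where j' = π σ₂ ⟨$⟩ʳ j

idSP : SignedPerm n
idSP = mkSignedPerm P.id (λ _ → z1) (λ _ → inj₁ refl)

act-id : (w : Word n) → act idSP w ≡ w
act-id w = vext λ j → trans (lookup-act idSP w j) (*₄-identityˡ (lookup w j))

unsigned : Permutation′ n → SignedPerm n
unsigned ρ = mkSignedPerm ρ (λ _ → z1) (λ _ → inj₁ refl)

lookup-unsigned : (ρ : Permutation′ n) (x : Word n) (i : Fin n) → lookup (act (unsigned ρ) x) i ≡ lookup x (ρ ⟨$⟩ʳ i)
lookup-unsigned ρ x i = trans (lookup-act (unsigned ρ) x i) (*₄-identityˡ _)

signs : (sg : Fin n → ℤ₄) → (∀ j → Unit (sg j)) → SignedPerm n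
signs sg sg-unit = mkSignedPerm P.id sg sg-unit

_⊕_ : ∀ {a b} → SignedPerm a → SignedPerm b → SignedPerm (a + b)
_⊕_ {a} {b} σ₁ σ₂ = mkSignedPerm
  (permutation (join⊎ (π σ₁ ⟨$⟩ʳ_) (π σ₂ ⟨$⟩ʳ_)) (join⊎ (π σ₁ ⟨$⟩ˡ_) (π σ₂ ⟨$⟩ˡ_))
     (join⊎-inverse (λ _ → inverseʳ (π σ₁)) (λ _ → inverseʳ (π σ₂)))
     (join⊎-inverse (λ _ → inverseˡ (π σ₁)) (λ _ → inverseˡ (π σ₂))))
  (λ i → Sum.[ s σ₁ , s σ₂ ] (splitAt a i))
  (λ i → unit-split i)
  where
  join⊎ : ∀ {a b} → (Fin a → Fin a) → (Fin b → Fin b) → Fin (a + b) → Fin (a + b)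
  join⊎ {a} {b} f g i = join a b (Sum.map f g (splitAt a i))
  join⊎-inverse : ∀ {a b} {f f' : Fin a → Fin a} {g g' : Fin b → Fin b} →
    (∀ x → f (f' x) ≡ x) → (∀ x → g (g' x) ≡ x) → ∀ i → join⊎ f g (join⊎ f' g' i) ≡ i
  join⊎-inverse {a} {b} {f} {f'} {g} {g'} p q i with splitAt a i in eq
  ... | inj₁ x = trans (cong (λ t → join a b (Sum.map f g t)) (splitAt-↑ˡ a (f' x) b))
                   (trans (cong (_↑ˡ b) (p x)) (trans (cong (join a b) (sym eq)) (join-splitAt a b i)))
  ... | inj₂ y = trans (cong (λ t → join a b (Sum.map f g t)) (splitAt-↑ʳ a b (g' y)))
                   (trans (cong (a ↑ʳ_) (q y)) (trans (cong (join a b) (sym eq)) (join-splitAt a b i)))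
  unit-split : ∀ i → Unit (Sum.[ s σ₁ , s σ₂ ] (splitAt a i))
  unit-split i with splitAt a i
  ... | inj₁ x = s-unit σ₁ x
  ... | inj₂ y = s-unit σ₂ y

act-⊕ : ∀ {a b} (σ₁ : SignedPerm a) (σ₂ : SignedPerm b) (u : Word a) (v : Word b) →
  act (σ₁ ⊕ σ₂) (u ++ v) ≡ act σ₁ u ++ act σ₂ v
act-⊕ {a} {b} σ₁ σ₂ u v = vext λ i → trans (lookup-act (σ₁ ⊕ σ₂) (u ++ v) i) (blockwise i)
  where
  back : ∀ i {x} → splitAt a i ≡ x → join a b x ≡ i
  back i eq = trans (cong (join a b) (sym eq)) (join-splitAt a b i)
  blockwise : ∀ i → s (σ₁ ⊕ σ₂) i *₄ lookup (u ++ v) (π (σ₁ ⊕ σ₂) ⟨$⟩ʳ i) ≡ lookup (act σ₁ u ++ act σ₂ v) i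
  blockwise i with splitAt a i in eq
  ... | inj₁ x = trans (cong (s σ₁ x *₄_) (lookup-++ˡ u v _))
                   (trans (sym (lookup-act σ₁ u x)) (trans (sym (lookup-++ˡ (act σ₁ u) (act σ₂ v) x))
                   (cong (lookup (act σ₁ u ++ act σ₂ v)) (back i eq))))
  ... | inj₂ y = trans (cong (s σ₂ y *₄_) (lookup-++ʳ u v _))
                   (trans (sym (lookup-act σ₂ v y)) (trans (sym (lookup-++ʳ (act σ₁ u) (act σ₂ v) y))
                   (cong (lookup (act σ₁ u ++ act σ₂ v)) (back i eq))))

δ : Fin n → Fin n → ℤ₄ → ℤ₄
δ i j c = if does (i ≟ᶠ j) then c else z0

δ-cases : (i j : Fin n) (c : ℤ₄) → (i ≡ j × δ i j c ≡ c) ⊎ (i ≢ j × δ i j c ≡ z0)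
δ-cases i j c with i ≟ᶠ j
... | yes e = inj₁ (e , refl)
... | no ne = inj₂ (ne , refl)

δ-diagonal : (i : Fin n) (c : ℤ₄) → δ i i c ≡ c
δ-diagonal i c rewrite dec-true (i ≟ᶠ i) refl = refl

dot-δ : (v : Word n) (p : Fin n) (c : ℤ₄) → dot v (tabulate (λ i → δ i p c)) ≡ lookup v p *₄ c
dot-δ (a ∷ v) zero c =
  trans (cong (a *₄ c +₄_) (trans (cong (dot v) (tabulate-const _)) (dot-zeroʳ v))) (+₄-identityʳ _)
  where
  tabulate-const : ∀ n → tabulate {n} (λ _ → z0) ≡ 0ᵛ
  tabulate-const zero = refl
  tabulate-const (suc n) = cong (z0 ∷_) (tabulate-const n)
dot-δ (a ∷ v) (suc p) c = trans (cong₂ _+₄_ (*₄-zeroʳ a) (dot-δ v p c)) (+₄-identityˡ _)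

entry-tabulate : (f : Fin m → Fin n → ℤ₄) (i : Fin m) (j : Fin n) →
  entry (tabulate λ a → tabulate (f a)) i j ≡ f i j
entry-tabulate f i j = trans (cong (λ r → lookup r j) (lookup∘tabulate _ i)) (lookup∘tabulate (f i) j)

column-tabulate : (f : Fin m → Fin n → ℤ₄) (j : Fin n) → column (tabulate λ a → tabulate (f a)) j ≡ tabulate (λ i → f i j)
column-tabulate {zero} f j = refl
column-tabulate {suc m} f j = cong₂ _∷_ (lookup∘tabulate (f zero) j) (column-tabulate (λ i → f (suc i)) j)

PM : SignedPerm n → Matrix n n
PM σ = tabulate (λ i → tabulate (λ j → δ i (π σ ⟨$⟩ʳ j) (s σ j)))

vecMat-PM : (σ : SignedPerm n) (v : Word n) → vecMat v (PM σ) ≡ act σ v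
vecMat-PM σ v = vext pointwise
  where
  open ≡-Reasoning
  pointwise : ∀ j → lookup (vecMat v (PM σ)) j ≡ lookup (act σ v) j
  pointwise j = begin
    lookup (vecMat v (PM σ)) j                            ≡⟨ lookup-vecMat v (PM σ) j ⟩
    dot v (column (PM σ) j)                               ≡⟨ cong (dot v) (column-tabulate _ j) ⟩
    dot v (tabulate (λ i → δ i (π σ ⟨$⟩ʳ j) (s σ j)))      ≡⟨ dot-δ v (π σ ⟨$⟩ʳ j) (s σ j) ⟩
    lookup v (π σ ⟨$⟩ʳ j) *₄ s σ j                        ≡⟨ *₄-comm _ (s σ j) ⟩
    s σ j *₄ lookup v (π σ ⟨$⟩ʳ j)                        ≡⟨ sym (lookup-act σ v j) ⟩
    lookup (act σ v) j                                    ∎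

PM-signedMonomial : (σ : SignedPerm n) → IsSignedMonomial (PM σ)
PM-signedMonomial σ = rows , cols , values
  where
  entry-PM : ∀ i j → entry (PM σ) i j ≡ δ i (π σ ⟨$⟩ʳ j) (s σ j)
  entry-PM = entry-tabulate (λ i j → δ i (π σ ⟨$⟩ʳ j) (s σ j))
  unit≢0 : ∀ {u} → Unit u → u ≢ z0
  unit≢0 (inj₁ refl) ()
  unit≢0 (inj₂ refl) ()
  nonzero⇒row : ∀ i j → entry (PM σ) i j ≢ z0 → i ≡ π σ ⟨$⟩ʳ j
  nonzero⇒row i j ne with δ-cases i (π σ ⟨$⟩ʳ j) (s σ j)
  ... | inj₁ (e , _) = e
  ... | inj₂ (_ , e) = ⊥-elim (ne (trans (entry-PM i j) e))
  diagonal-nonzero : ∀ j → entry (PM σ) (π σ ⟨$⟩ʳ j) j ≢ z0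
  diagonal-nonzero j e = unit≢0 (s-unit σ j) (trans (sym (δ-diagonal (π σ ⟨$⟩ʳ j) (s σ j))) (trans (sym (entry-PM (π σ ⟨$⟩ʳ j) j)) e))
  rows : ∀ i → ∃ λ j → entry (PM σ) i j ≢ z0 × (∀ j' → entry (PM σ) i j' ≢ z0 → j' ≡ j)
  rows i = π σ ⟨$⟩ˡ i ,
    subst (λ r → entry (PM σ) r (π σ ⟨$⟩ˡ i) ≢ z0) (inverseʳ (π σ)) (diagonal-nonzero (π σ ⟨$⟩ˡ i)) ,
    λ j' ne → trans (sym (inverseˡ (π σ))) (cong (π σ ⟨$⟩ˡ_) (sym (nonzero⇒row i j' ne)))
  cols : ∀ j → ∃ λ i → entry (PM σ) i j ≢ z0 × (∀ i' → entry (PM σ) i' j ≢ z0 → i' ≡ i)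
  cols j = π σ ⟨$⟩ʳ j , diagonal-nonzero j , λ i' ne → nonzero⇒row i' j ne
  values : ∀ i j → entry (PM σ) i j ≡ z0 ⊎ entry (PM σ) i j ≡ z1 ⊎ entry (PM σ) i j ≡ z3
  values i j with δ-cases i (π σ ⟨$⟩ʳ j) (s σ j) | s-unit σ j
  ... | inj₂ (_ , e) | _ = inj₁ (trans (entry-PM i j) e)
  ... | inj₁ (_ , e) | inj₁ u = inj₂ (inj₁ (trans (entry-PM i j) (trans e u)))
  ... | inj₁ (_ , e) | inj₂ u = inj₂ (inj₂ (trans (entry-PM i j) (trans e u)))

transport : SignedPerm n → Code n → Code n
transport σ C w = C (act (inv σ) w)

transport-equivalent : (σ : SignedPerm n) (C : Code n) → Equivalent C (transport σ C)
transport-equivalent σ C = PM σ , PM-signedMonomial σ , λ w →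
  (λ p → act (inv σ) w , p , trans (sym (act-act-inv σ w)) (sym (vecMat-PM σ _))) ,
  (λ { (v , p , refl) → subst (_≡ true) (cong C (sym (trans (cong (act (inv σ)) (vecMat-PM σ v)) (act-inv-act σ v)))) p })

transport-isCode : (σ : SignedPerm n) (C : Code n) → IsCode C → IsCode (transport σ C)
transport-isCode σ C (C0 , C+ , C·) =
  subst (_≡ true) (cong C (sym (act-0ᵛ (inv σ)))) C0 ,
  (λ u v pu pv → subst (_≡ true) (cong C (sym (act-+ (inv σ) u v))) (C+ _ _ pu pv)) ,
  (λ c u pu → subst (_≡ true) (cong C (sym (act-· (inv σ) c u))) (C· c _ pu))

transport-hasType : ∀ {k₁ k₂} (σ : SignedPerm n) (C : Code n) → HasType C k₁ k₂ → HasType (transport σ C) k₁ k₂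
transport-hasType σ C (φ , φ-additive , φ-injective , φ-into , φ-onto) =
  (λ x → act σ (φ x)) ,
  (λ x₁ x₂ y₁ y₂ → trans (cong (act σ) (φ-additive x₁ x₂ y₁ y₂)) (act-+ σ _ _)) ,
  (λ x y e → φ-injective x y (trans (sym (act-inv-act σ (φ x))) (trans (cong (act (inv σ)) e) (act-inv-act σ (φ y))))) ,
  (λ x → subst (_≡ true) (cong C (sym (act-inv-act σ (φ x)))) (φ-into x)) ,
  (λ w p → let (x , e) = φ-onto _ p in x , trans (cong (act σ) e) (act-act-inv σ w))

Span : Matrix k n → Word n → Set
Span {k} M w = ∃ λ (c : Word k) → w ≡ vecMat c M

Carries : SignedPerm n → (Word n → Set) → (Word n → Set) → Set
Carries σ P Q = (∀ w → P w → Q (act σ w)) × (∀ w → Q w → P (act (inv σ) w))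

carries-⨾ : {σ τ : SignedPerm n} {P Q R : Word n → Set} → Carries σ P Q → Carries τ Q R → Carries (σ ⨾ τ) P R
carries-⨾ {σ = σ} {τ} {P} {Q} {R} (σ→ , σ←) (τ→ , τ←) =
  (λ w p → subst R (sym (act-⨾ σ τ w)) (τ→ _ (σ→ w p))) ,
  (λ w r → subst P (sym (inv-unique (σ ⨾ τ) (undo w))) (σ← _ (τ← w r)))
  where
  undo : ∀ w → act (σ ⨾ τ) (act (inv σ) (act (inv τ) w)) ≡ w
  undo w = trans (act-⨾ σ τ _) (trans (cong (act τ) (act-act-inv σ _)) (act-act-inv τ w))

carries-id : {P Q : Word n → Set} → (∀ w → P w → Q w) → (∀ w → Q w → P w) → Carries idSP P Q
carries-id {P = P} {Q = Q} P⊆Q Q⊆P =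
  (λ w p → subst Q (sym (act-id w)) (P⊆Q w p)) ,
  (λ w q → subst P (sym (inv-unique idSP (act-id w))) (Q⊆P w q))

retarget : {σ : SignedPerm n} {P : Word n → Set} {M N : Matrix k n} → M ≡ N → Carries σ P (Span M) → Carries σ P (Span N)
retarget refl c = c

carries-span : (σ : SignedPerm n) (M : Matrix k n) → Carries σ (Span M) (Span (map (act σ) M))
carries-span σ M =
  (λ { w (c , refl) → c , act-vecMat σ c M }) ,
  (λ { w (c , refl) → c , inv-unique σ (act-vecMat σ c M) })

-- The identity matrix.  Its diagonal is defined by a decision i ≟ j hidden
-- inside idMat; generalising over the entry exposes that decision.

idMat-entry : (i j : Fin n) → entry (idMat n) i j ≡ δ i j z1
idMat-entry {n} i j with entry (idMat n) i j | (entry (idMat n) i j ≡ _ ∋ entry-tabulate _ i j)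
... | _ | refl with i ≟ᶠ j
...   | yes _ = refl
...   | no _ = refl

idMat-PM : idMat n ≡ PM idSP
idMat-PM = vext λ i → vext λ j → trans (idMat-entry i j) (sym (entry-tabulate _ i j))

vecMat-idMat : (x : Word n) → vecMat x (idMat n) ≡ x
vecMat-idMat x = trans (cong (vecMat x) idMat-PM) (trans (vecMat-PM idSP x) (act-id x))

idMat-suc : idMat (suc n) ≡ (z1 ∷ 0ᵛ) ∷ map (z0 ∷_) (idMat n)
idMat-suc {n} = vext λ where
  zero → vext λ where
    zero → idMat-entry {suc n} zero zero
    (suc j) → trans (idMat-entry {suc n} zero (suc j)) (sym (lookup-0ᵛ j))
  (suc i) → trans (vext λ where
      zero → idMat-entry (suc i) zero
      (suc j) → trans (idMat-entry (suc i) (suc j)) (sym (idMat-entry i j)))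
    (sym (lookup-map i (z0 ∷_) (idMat n)))

vecMat-zeroMat : (y : Word k) → vecMat y (zeroMat k m) ≡ 0ᵛ
vecMat-zeroMat [] = refl
vecMat-zeroMat (a ∷ y) = trans (cong₂ _+ᵛ_ (·ᵛ-zeroʳ a) (vecMat-zeroMat y)) 0ᵛ+ᵛ0ᵛ

vecMat-∣∣ : ∀ {a b} (x : Word k) (M : Matrix k a) (N : Matrix k b) → vecMat x (M ∣∣ N) ≡ vecMat x M ++ vecMat x N
vecMat-∣∣ {a = a} {b} [] [] [] = ++-0ᵛ {a} {b}
vecMat-∣∣ (c ∷ x) (r ∷ M) (t ∷ N) = begin
  (c ·ᵛ (r ++ t)) +ᵛ vecMat x (M ∣∣ N)                  ≡⟨ cong₂ _+ᵛ_ (++-·ᵛ c r t) (vecMat-∣∣ x M N) ⟩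
  ((c ·ᵛ r) ++ (c ·ᵛ t)) +ᵛ (vecMat x M ++ vecMat x N) ≡⟨ ++-+ᵛ (c ·ᵛ r) (vecMat x M) (c ·ᵛ t) (vecMat x N) ⟩
  ((c ·ᵛ r) +ᵛ vecMat x M) ++ ((c ·ᵛ t) +ᵛ vecMat x N) ∎
  where open ≡-Reasoning

vecMat-scaleMat : (y : Word k) (c : ℤ₄) (M : Matrix k n) → vecMat y (scaleMat c M) ≡ c ·ᵛ vecMat y M
vecMat-scaleMat [] c [] = sym (·ᵛ-zeroʳ c)
vecMat-scaleMat (a ∷ y) c (r ∷ M) = begin
  (a ·ᵛ (c ·ᵛ r)) +ᵛ vecMat y (scaleMat c M)  ≡⟨ cong₂ _+ᵛ_ swap (vecMat-scaleMat y c M) ⟩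
  (c ·ᵛ (a ·ᵛ r)) +ᵛ (c ·ᵛ vecMat y M)        ≡⟨ sym (·ᵛ-distribˡ c _ _) ⟩
  c ·ᵛ ((a ·ᵛ r) +ᵛ vecMat y M)               ∎
  where
  open ≡-Reasoning
  swap : a ·ᵛ (c ·ᵛ r) ≡ c ·ᵛ (a ·ᵛ r)
  swap = trans (sym (·ᵛ-assoc a c r)) (trans (cong (_·ᵛ r) (*₄-comm a c)) (·ᵛ-assoc c a r))

vecMat-cons0 : (c : Word k) (R : Matrix k n) → vecMat c (map (z0 ∷_) R) ≡ z0 ∷ vecMat c R
vecMat-cons0 [] [] = refl
vecMat-cons0 (a ∷ c) (r ∷ R) = trans (cong ((a ·ᵛ (z0 ∷ r)) +ᵛ_) (vecMat-cons0 c R))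
  (cong (_∷ ((a ·ᵛ r) +ᵛ vecMat c R)) (trans (+₄-identityʳ _) (*₄-zeroʳ a)))

gword : ∀ {k₁ k₂ ℓ} → Matrix k₁ k₂ → Matrix k₁ ℓ → Matrix k₂ ℓ → Word k₁ → Word k₂ → Word (k₁ + k₂ + ℓ)
gword A B D x y = (x ++ (vecMat x A +ᵛ (z2 ·ᵛ y))) ++ (vecMat x B +ᵛ (z2 ·ᵛ vecMat y D))

vecMat-GMat : ∀ {k₁ k₂ ℓ} (A : Matrix k₁ k₂) (B : Matrix k₁ ℓ) (D : Matrix k₂ ℓ) (x : Word k₁) (y : Word k₂) →
  vecMat (x ++ y) (GMat A B D) ≡ gword A B D x y
vecMat-GMat {k₁} {k₂} A B D x y = begin
  vecMat (x ++ y) (GMat A B D)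
    ≡⟨ vecMat-++ x y _ _ ⟩
  vecMat x ((idMat k₁ ∣∣ A) ∣∣ B) +ᵛ vecMat y ((zeroMat k₂ k₁ ∣∣ scaleMat z2 (idMat k₂)) ∣∣ scaleMat z2 D)
    ≡⟨ cong₂ _+ᵛ_ top bottom ⟩
  ((x ++ vecMat x A) ++ vecMat x B) +ᵛ ((0ᵛ ++ (z2 ·ᵛ y)) ++ (z2 ·ᵛ vecMat y D))
    ≡⟨ ++-+ᵛ (x ++ vecMat x A) (0ᵛ ++ (z2 ·ᵛ y)) (vecMat x B) (z2 ·ᵛ vecMat y D) ⟩
  ((x ++ vecMat x A) +ᵛ (0ᵛ ++ (z2 ·ᵛ y))) ++ (vecMat x B +ᵛ (z2 ·ᵛ vecMat y D))
    ≡⟨ cong (_++ (vecMat x B +ᵛ (z2 ·ᵛ vecMat y D))) (trans (++-+ᵛ x 0ᵛ (vecMat x A) (z2 ·ᵛ y)) (cong (_++ (vecMat x A +ᵛ (z2 ·ᵛ y))) (+ᵛ-identityʳ x))) ⟩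
  gword A B D x y ∎
  where
  open ≡-Reasoning
  top : vecMat x ((idMat k₁ ∣∣ A) ∣∣ B) ≡ (x ++ vecMat x A) ++ vecMat x B
  top = trans (vecMat-∣∣ x _ B) (cong (_++ vecMat x B) (trans (vecMat-∣∣ x _ A) (cong (_++ vecMat x A) (vecMat-idMat x))))
  bottom : vecMat y ((zeroMat k₂ k₁ ∣∣ scaleMat z2 (idMat k₂)) ∣∣ scaleMat z2 D) ≡ (0ᵛ ++ (z2 ·ᵛ y)) ++ (z2 ·ᵛ vecMat y D)
  bottom = trans (vecMat-∣∣ y _ _) (cong₂ _++_
    (trans (vecMat-∣∣ y _ _) (cong₂ _++_ (vecMat-zeroMat y) (trans (vecMat-scaleMat y z2 (idMat k₂)) (cong (z2 ·ᵛ_) (vecMat-idMat y)))))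
    (vecMat-scaleMat y z2 D))

span-GMat : ∀ {k₁ k₂ ℓ} (A : Matrix k₁ k₂) (B : Matrix k₁ ℓ) (D : Matrix k₂ ℓ) {w : Word (k₁ + k₂ + ℓ)} →
  Span (GMat A B D) w → ∃ λ x → ∃ λ y → w ≡ gword A B D x y
span-GMat {k₁} A B D (c , eq) with Data.Vec.splitAt k₁ c
... | x , y , refl = x , y , trans eq (vecMat-GMat A B D x y)

gword-span : ∀ {k₁ k₂ ℓ} (A : Matrix k₁ k₂) (B : Matrix k₁ ℓ) (D : Matrix k₂ ℓ) (x : Word k₁) (y : Word k₂) →
  Span (GMat A B D) (gword A B D x y)
gword-span A B D x y = (x ++ y) , sym (vecMat-GMat A B D x y)

carries-GMat : ∀ {k₁ k₂ ℓ} {A A' : Matrix k₁ k₂} {B B' : Matrix k₁ ℓ} {D D' : Matrix k₂ ℓ}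
  (τ : SignedPerm (k₁ + k₂ + ℓ)) (f g : Word k₁ → Word k₁) → (∀ x → f (g x) ≡ x) →
  (∀ x y → act τ (gword A B D x y) ≡ gword A' B' D' (f x) y) →
  Carries τ (Span (GMat A B D)) (Span (GMat A' B' D'))
carries-GMat {A = A} {A'} {B} {B'} {D} {D'} τ f g fg eq = forward , backward
  where
  forward : ∀ w → Span (GMat A B D) w → Span (GMat A' B' D') (act τ w)
  forward w p with span-GMat A B D p
  ... | x , y , refl = subst (Span (GMat A' B' D')) (sym (eq x y)) (gword-span A' B' D' (f x) y)
  backward : ∀ w → Span (GMat A' B' D') w → Span (GMat A B D) (act (inv τ) w)
  backward w p with span-GMat A' B' D' p
  ... | x , y , refl = subst (Span (GMat A B D))
         (sym (inv-unique τ (trans (eq (g x) y) (cong (λ t → gword A' B' D' t y) (fg x))))) (gword-span A B D (g x) y)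

in02-+ : ∀ {a b} → In02 a → In02 b → In02 (a +₄ b)
in02-+ (inj₁ refl) (inj₁ refl) = inj₁ refl
in02-+ (inj₁ refl) (inj₂ refl) = inj₂ refl
in02-+ (inj₂ refl) (inj₁ refl) = inj₂ refl
in02-+ (inj₂ refl) (inj₂ refl) = inj₁ refl

in02-*ʳ : ∀ a {b} → In02 b → In02 (a *₄ b)
in02-*ʳ z0 (inj₁ refl) = inj₁ refl
in02-*ʳ z1 (inj₁ refl) = inj₁ refl
in02-*ʳ z2 (inj₁ refl) = inj₁ refl
in02-*ʳ z3 (inj₁ refl) = inj₁ refl
in02-*ʳ z0 (inj₂ refl) = inj₁ refl
in02-*ʳ z1 (inj₂ refl) = inj₂ refl
in02-*ʳ z2 (inj₂ refl) = inj₁ refl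
in02-*ʳ z3 (inj₂ refl) = inj₂ refl

in02-*ˡ : ∀ {a} → In02 a → ∀ b → In02 (a *₄ b)
in02-*ˡ {a} p b = subst In02 (*₄-comm b a) (in02-*ʳ b p)

in02-*-zero : ∀ {a b} → In02 a → In02 b → a *₄ b ≡ z0
in02-*-zero (inj₁ refl) (inj₁ refl) = refl
in02-*-zero (inj₁ refl) (inj₂ refl) = refl
in02-*-zero (inj₂ refl) (inj₁ refl) = refl
in02-*-zero (inj₂ refl) (inj₂ refl) = refl

in02-cancel : ∀ a {d} → In02 (a +₄ d) → In02 d → In02 a
in02-cancel a {d} ad d2 = subst In02 (cancel a d) (in02-+ ad (in02-*ʳ z3 d2))
  where
  cancel : ∀ a d → (a +₄ d) +₄ z3 *₄ d ≡ a
  cancel = decide₂ (λ a d → (a +₄ d) +₄ z3 *₄ d) (λ a d → a)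

Even : Word n → Set
Even = All In02

AllEven : Matrix k n → Set
AllEven = All Even

even-+ : {u v : Word n} → Even u → Even v → Even (u +ᵛ v)
even-+ [] [] = []
even-+ (p ∷ ps) (q ∷ qs) = in02-+ p q ∷ even-+ ps qs

even-·ˡ : ∀ {c} → In02 c → (v : Word n) → Even (c ·ᵛ v)
even-·ˡ p [] = []
even-·ˡ p (b ∷ v) = in02-*ˡ p b ∷ even-·ˡ p v

even-·ʳ : ∀ c {v : Word n} → Even v → Even (c ·ᵛ v)
even-·ʳ c [] = []
even-·ʳ c (p ∷ ps) = in02-*ʳ c p ∷ even-·ʳ c ps

even-tail : {w : Word (suc n)} → Even w → Even (tail w)
even-tail {w = _ ∷ _} (_ ∷ e) = e

even-two : {w : Word n} → Even w → z2 ·ᵛ w ≡ 0ᵛ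
even-two [] = refl
even-two (p ∷ ps) = cong₂ _∷_ (in02-*-zero (inj₂ refl) p) (even-two ps)

even-act : (σ : SignedPerm n) {w : Word n} → Even w → Even (act σ w)
even-act σ {w} e = lookup⁻ λ j → subst In02 (sym (lookup-act σ w j)) (in02-*ʳ (s σ j) (lookup⁺ e _))

dot-even : {z v : Word k} → Even z → Even v → dot z v ≡ z0
dot-even [] [] = refl
dot-even (p ∷ ps) (q ∷ qs) = cong₂ _+₄_ (in02-*-zero p q) (dot-even ps qs)

dot-evenˡ : {z : Word k} → Even z → (v : Word k) → In02 (dot z v)
dot-evenˡ [] [] = inj₁ refl
dot-evenˡ (p ∷ ps) (b ∷ v) = in02-+ (in02-*ˡ p b) (dot-evenˡ ps v)

-- A family of generators (gs ; hs) with the hs even is independent when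
-- x gs + z hs = 0 forces x = 0 and z even: then x ↦ x gs, z ↦ z hs realise
-- ℤ₄^k₁ × ℤ₂^k₂ inside ℤ₄ⁿ.
Independent : ∀ {k₁ k₂} → Matrix k₁ n → Matrix k₂ n → Set
Independent {n} {k₁} {k₂} gs hs =
  ∀ (x : Word k₁) (z : Word k₂) → vecMat (x ++ z) (gs ++ hs) ≡ 0ᵛ → x ≡ 0ᵛ × Even z

independent-act : ∀ {k₁ k₂} (σ : SignedPerm n) (gs : Matrix k₁ n) (hs : Matrix k₂ n) →
  Independent gs hs → Independent (map (act σ) gs) (map (act σ) hs)
independent-act σ gs hs ind x z eq = ind x z (begin
  vecMat (x ++ z) (gs ++ hs)                             ≡⟨ sym (inv-unique σ (act-vecMat σ (x ++ z) (gs ++ hs))) ⟩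
  act (inv σ) (vecMat (x ++ z) (map (act σ) (gs ++ hs))) ≡⟨ cong (λ M → act (inv σ) (vecMat (x ++ z) M)) (map-++ (act σ) gs hs) ⟩
  act (inv σ) (vecMat (x ++ z) (map (act σ) gs ++ map (act σ) hs)) ≡⟨ cong (act (inv σ)) eq ⟩
  act (inv σ) 0ᵛ                                         ≡⟨ act-0ᵛ (inv σ) ⟩
  0ᵛ                                                     ∎)
  where open ≡-Reasoning

ι : ℤ₂ → ℤ₄
ι o0 = z0
ι o1 = z1

reduce₂ : ℤ₄ → ℤ₂
reduce₂ z0 = o0
reduce₂ z1 = o1
reduce₂ z2 = o0
reduce₂ z3 = o1

0₂ : Vec ℤ₂ n
0₂ = replicate _ o0

0₂+0₂ : 0₂ +₂ᵛ 0₂ ≡ 0₂ {n}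
0₂+0₂ {zero} = refl
0₂+0₂ {suc n} = cong (o0 ∷_) (0₂+0₂ {n})

+₂ᵛ-identityˡ : (y : Vec ℤ₂ n) → 0₂ +₂ᵛ y ≡ y
+₂ᵛ-identityˡ [] = refl
+₂ᵛ-identityˡ (b ∷ y) = cong (b ∷_) (+₂ᵛ-identityˡ y)

Additive₄ : (Vec ℤ₄ k → Word n) → Set
Additive₄ ψ = ∀ x y → ψ (x +ᵛ y) ≡ ψ x +ᵛ ψ y

matrix₄ : (Vec ℤ₄ k → Word n) → Matrix k n
matrix₄ {zero} ψ = []
matrix₄ {suc k} ψ = ψ (z1 ∷ 0ᵛ) ∷ matrix₄ (λ x → ψ (z0 ∷ x))

additive₄-zero : (ψ : Vec ℤ₄ k → Word n) → Additive₄ ψ → ψ 0ᵛ ≡ 0ᵛ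
additive₄-zero ψ ad = double-zero (ψ 0ᵛ) (trans (cong ψ (sym 0ᵛ+ᵛ0ᵛ)) (ad 0ᵛ 0ᵛ))

additive₄-linear : (ψ : Vec ℤ₄ k → Word n) → Additive₄ ψ → ∀ x → ψ x ≡ vecMat x (matrix₄ ψ)
additive₄-linear {zero} ψ ad [] = additive₄-zero ψ ad
additive₄-linear {suc k} ψ ad (c ∷ x) = begin
  ψ (c ∷ x)                       ≡⟨ cong ψ (cong₂ _∷_ (sym (+₄-identityʳ c)) (sym (+ᵛ-identityˡ x))) ⟩
  ψ ((c ∷ 0ᵛ) +ᵛ (z0 ∷ x))        ≡⟨ ad _ _ ⟩
  ψ (c ∷ 0ᵛ) +ᵛ ψ (z0 ∷ x)        ≡⟨ cong₂ _+ᵛ_ (scalar c) (additive₄-linear (λ y → ψ (z0 ∷ y)) (λ y y' → ad (z0 ∷ y) (z0 ∷ y')) x) ⟩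
  (c ·ᵛ v) +ᵛ vecMat x (matrix₄ (λ y → ψ (z0 ∷ y))) ∎
  where
  open ≡-Reasoning
  v = ψ (z1 ∷ 0ᵛ)
  -- additivity gives ψ (c e₁) = c ψ (e₁) for c = 0, 1, 2 = 1 + 1, 3 = 2 + 1
  double : ψ (z2 ∷ 0ᵛ) ≡ v +ᵛ v
  double = trans (cong ψ (cong (z2 ∷_) (sym 0ᵛ+ᵛ0ᵛ))) (ad (z1 ∷ 0ᵛ) (z1 ∷ 0ᵛ))
  two· : ∀ {m} (u : Word m) → z2 ·ᵛ u ≡ u +ᵛ u
  two· [] = refl
  two· (a ∷ u) = cong₂ _∷_ (decide₁ (z2 *₄_) (λ a → a +₄ a) a) (two· u)
  three· : ∀ {m} (u : Word m) → z3 ·ᵛ u ≡ (u +ᵛ u) +ᵛ u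
  three· [] = refl
  three· (a ∷ u) = cong₂ _∷_ (decide₁ (z3 *₄_) (λ a → (a +₄ a) +₄ a) a) (three· u)
  scalar : ∀ c → ψ (c ∷ 0ᵛ) ≡ c ·ᵛ v
  scalar z0 = trans (additive₄-zero ψ ad) (sym (·ᵛ-zeroˡ v))
  scalar z1 = sym (·ᵛ-identity v)
  scalar z2 = trans double (sym (two· v))
  scalar z3 = trans (cong ψ (cong (z3 ∷_) (sym 0ᵛ+ᵛ0ᵛ)))
    (trans (ad (z2 ∷ 0ᵛ) (z1 ∷ 0ᵛ)) (trans (cong (_+ᵛ v) double) (sym (three· v))))

Additive₂ : (Vec ℤ₂ k → Word n) → Set
Additive₂ χ = ∀ x y → χ (x +₂ᵛ y) ≡ χ x +ᵛ χ y

matrix₂ : (Vec ℤ₂ k → Word n) → Matrix k n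
matrix₂ {zero} χ = []
matrix₂ {suc k} χ = χ (o1 ∷ 0₂) ∷ matrix₂ (λ y → χ (o0 ∷ y))

additive₂-zero : (χ : Vec ℤ₂ k → Word n) → Additive₂ χ → χ 0₂ ≡ 0ᵛ
additive₂-zero χ ad = double-zero (χ 0₂) (trans (cong χ (sym 0₂+0₂)) (ad 0₂ 0₂))

additive₂-linear : (χ : Vec ℤ₂ k → Word n) → Additive₂ χ → ∀ y → χ y ≡ vecMat (map ι y) (matrix₂ χ)
additive₂-linear {zero} χ ad [] = additive₂-zero χ ad
additive₂-linear {suc k} χ ad (b ∷ y) = begin
  χ (b ∷ y)                  ≡⟨ cong χ (cong₂ _∷_ (sym (+₂-identityʳ b)) (sym (+₂ᵛ-identityˡ y))) ⟩
  χ ((b ∷ 0₂) +₂ᵛ (o0 ∷ y))  ≡⟨ ad _ _ ⟩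
  χ (b ∷ 0₂) +ᵛ χ (o0 ∷ y)   ≡⟨ cong₂ _+ᵛ_ (scalar b) (additive₂-linear (λ y → χ (o0 ∷ y)) (λ u u' → ad (o0 ∷ u) (o0 ∷ u')) y) ⟩
  (ι b ·ᵛ χ (o1 ∷ 0₂)) +ᵛ vecMat (map ι y) (matrix₂ (λ y → χ (o0 ∷ y))) ∎
  where
  open ≡-Reasoning
  +₂-identityʳ : ∀ b → b +₂ o0 ≡ b
  +₂-identityʳ o0 = refl
  +₂-identityʳ o1 = refl
  scalar : ∀ b → χ (b ∷ 0₂) ≡ ι b ·ᵛ χ (o1 ∷ 0₂)
  scalar o0 = trans (additive₂-zero χ ad) (sym (·ᵛ-zeroˡ _))
  scalar o1 = sym (·ᵛ-identity _)

order-two-even : (w : Word n) → w +ᵛ w ≡ 0ᵛ → Even w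
order-two-even [] _ = []
order-two-even (z0 ∷ w) eq = inj₁ refl ∷ order-two-even w (cong tail eq)
order-two-even (z2 ∷ w) eq = inj₂ refl ∷ order-two-even w (cong tail eq)

-- images of elements of ℤ₂^k have order 2, hence are even
matrix₂-even : (χ : Vec ℤ₂ k → Word n) → Additive₂ χ → AllEven (matrix₂ χ)
matrix₂-even {zero} χ ad = []
matrix₂-even {suc k} χ ad =
  order-two-even _ (trans (sym (ad (o1 ∷ 0₂) (o1 ∷ 0₂))) (trans (cong (λ t → χ (o0 ∷ t)) 0₂+0₂) (additive₂-zero χ ad)))
  ∷ matrix₂-even (λ y → χ (o0 ∷ y)) (λ u u' → ad (o0 ∷ u) (o0 ∷ u'))

vecMat-mod2 : (z : Word k) {H : Matrix k n} → AllEven H → vecMat z H ≡ vecMat (map ι (map reduce₂ z)) H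
vecMat-mod2 [] [] = refl
vecMat-mod2 (c ∷ z) (e ∷ es) = cong₂ _+ᵛ_ (row c e) (vecMat-mod2 z es)
  where
  scalar : ∀ c {a} → In02 a → c *₄ a ≡ ι (reduce₂ c) *₄ a
  scalar z0 (inj₁ refl) = refl
  scalar z1 (inj₁ refl) = refl
  scalar z2 (inj₁ refl) = refl
  scalar z3 (inj₁ refl) = refl
  scalar z0 (inj₂ refl) = refl
  scalar z1 (inj₂ refl) = refl
  scalar z2 (inj₂ refl) = refl
  scalar z3 (inj₂ refl) = refl
  row : ∀ c {h : Word n} → Even h → c ·ᵛ h ≡ ι (reduce₂ c) ·ᵛ h
  row c [] = refl
  row c (p ∷ e) = cong₂ _∷_ (scalar c p) (row c e)

reduce₂-zero : (z : Word k) → map reduce₂ z ≡ 0₂ → Even z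
reduce₂-zero [] _ = []
reduce₂-zero (z0 ∷ z) eq = inj₁ refl ∷ reduce₂-zero z (cong tail eq)
reduce₂-zero (z2 ∷ z) eq = inj₂ refl ∷ reduce₂-zero z (cong tail eq)

record Basis (C : Code n) (k₁ k₂ : ℕ) : Set where
  field
    gs : Matrix k₁ n
    hs : Matrix k₂ n
    hs-even : AllEven hs
    independent : Independent gs hs
    spans : ∀ w → w ∈ᶜ C → Span (gs ++ hs) w
    within : ∀ w → Span (gs ++ hs) w → w ∈ᶜ C

basis : ∀ {k₁ k₂} (C : Code n) → HasType C k₁ k₂ → Basis C k₁ k₂
basis {n} {k₁} {k₂} C (φ , φ-additive , φ-injective , φ-into , φ-onto) = record
  { gs = gs ; hs = hs ; hs-even = matrix₂-even χ χ-additive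
  ; independent = independent ; spans = spans ; within = within }
  where
  ψ : Vec ℤ₄ k₁ → Word n
  ψ x = φ (x , 0₂)
  χ : Vec ℤ₂ k₂ → Word n
  χ y = φ (0ᵛ , y)
  ψ-additive : Additive₄ ψ
  ψ-additive x y = trans (cong (λ t → φ (x +ᵛ y , t)) (sym 0₂+0₂)) (φ-additive x 0₂ y 0₂)
  χ-additive : Additive₂ χ
  χ-additive x y = trans (cong (λ t → φ (t , x +₂ᵛ y)) (sym 0ᵛ+ᵛ0ᵛ)) (φ-additive 0ᵛ x 0ᵛ y)
  gs = matrix₄ ψ
  hs = matrix₂ χ
  φ-matrix : ∀ x y → φ (x , y) ≡ vecMat (x ++ map ι y) (gs ++ hs)
  φ-matrix x y = trans (cong φ (cong₂ _,_ (sym (+ᵛ-identityʳ x)) (sym (+₂ᵛ-identityˡ y))))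
    (trans (φ-additive x 0₂ 0ᵛ y) (trans (cong₂ _+ᵛ_ (additive₄-linear ψ ψ-additive x) (additive₂-linear χ χ-additive y))
    (sym (vecMat-++ x (map ι y) gs hs))))
  combination-φ : ∀ x z → vecMat (x ++ z) (gs ++ hs) ≡ φ (x , map reduce₂ z)
  combination-φ x z = trans (vecMat-++ x z gs hs) (trans (cong (vecMat x gs +ᵛ_) (vecMat-mod2 z (matrix₂-even χ χ-additive)))
    (trans (sym (vecMat-++ x _ gs hs)) (sym (φ-matrix x (map reduce₂ z)))))
  independent : Independent gs hs
  independent x z eq with φ-injective (x , map reduce₂ z) (0ᵛ , 0₂)
                            (trans (sym (combination-φ x z)) (trans eq (sym (additive₄-zero ψ ψ-additive))))
  ... | e = cong proj₁ e , reduce₂-zero z (cong proj₂ e)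
  spans : ∀ w → w ∈ᶜ C → Span (gs ++ hs) w
  spans w p with φ-onto w p
  ... | (x , y) , eq = (x ++ map ι y) , trans (sym eq) (φ-matrix x y)
  within : ∀ w → Span (gs ++ hs) w → w ∈ᶜ C
  within w (c , eq) with Data.Vec.splitAt k₁ c
  ... | x , z , refl = subst (_∈ᶜ C) (sym (trans eq (combination-φ x z))) (φ-into (x , map reduce₂ z))

addMultiple : Word n → (Word n → ℤ₄) → Word n → Word n
addMultiple x t r = r +ᵛ (t r ·ᵛ x)

vecMat-addMultiple : (x : Word n) (t : Word n → ℤ₄) (c : Word k) (R : Matrix k n) →
  vecMat c (map (addMultiple x t) R) ≡ vecMat c R +ᵛ (dot c (map t R) ·ᵛ x)
vecMat-addMultiple x t [] [] = sym (trans (cong (0ᵛ +ᵛ_) (·ᵛ-zeroˡ x)) 0ᵛ+ᵛ0ᵛ)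
vecMat-addMultiple x t (a ∷ c) (r ∷ R) = begin
  (a ·ᵛ (r +ᵛ (t r ·ᵛ x))) +ᵛ vecMat c (map (addMultiple x t) R)
    ≡⟨ cong₂ _+ᵛ_ (·ᵛ-distribˡ a r _) (vecMat-addMultiple x t c R) ⟩
  ((a ·ᵛ r) +ᵛ (a ·ᵛ (t r ·ᵛ x))) +ᵛ (vecMat c R +ᵛ (dot c (map t R) ·ᵛ x))
    ≡⟨ +ᵛ-interchange _ _ _ _ ⟩
  ((a ·ᵛ r) +ᵛ vecMat c R) +ᵛ ((a ·ᵛ (t r ·ᵛ x)) +ᵛ (dot c (map t R) ·ᵛ x))
    ≡⟨ cong (((a ·ᵛ r) +ᵛ vecMat c R) +ᵛ_) (trans (cong (_+ᵛ (dot c (map t R) ·ᵛ x)) (sym (·ᵛ-assoc a (t r) x))) (sym (·ᵛ-distribʳ (a *₄ t r) _ x))) ⟩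
  ((a ·ᵛ r) +ᵛ vecMat c R) +ᵛ ((a *₄ t r +₄ dot c (map t R)) ·ᵛ x) ∎
  where open ≡-Reasoning

vecMat-addMultiple-pivot : (x : Word n) (t : Word n → ℤ₄) (c₀ : ℤ₄) (c : Word k) (R : Matrix k n) →
  vecMat (c₀ ∷ c) (x ∷ map (addMultiple x t) R) ≡ vecMat ((c₀ +₄ dot c (map t R)) ∷ c) (x ∷ R)
vecMat-addMultiple-pivot x t c₀ c R = begin
  (c₀ ·ᵛ x) +ᵛ vecMat c (map (addMultiple x t) R)       ≡⟨ cong ((c₀ ·ᵛ x) +ᵛ_) (trans (vecMat-addMultiple x t c R) (+ᵛ-comm _ _)) ⟩
  (c₀ ·ᵛ x) +ᵛ ((dot c (map t R) ·ᵛ x) +ᵛ vecMat c R)   ≡⟨ sym (+ᵛ-assoc _ _ _) ⟩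
  ((c₀ ·ᵛ x) +ᵛ (dot c (map t R) ·ᵛ x)) +ᵛ vecMat c R   ≡⟨ cong (_+ᵛ vecMat c R) (sym (·ᵛ-distribʳ c₀ _ x)) ⟩
  ((c₀ +₄ dot c (map t R)) ·ᵛ x) +ᵛ vecMat c R          ∎
  where open ≡-Reasoning

carries-addMultiple : (x : Word n) (t : Word n → ℤ₄) (R : Matrix k n) →
  Carries idSP (Span (x ∷ R)) (Span (x ∷ map (addMultiple x t) R))
carries-addMultiple x t R = carries-id forward backward
  where
  d : Word _ → ℤ₄
  d c = dot c (map t R)
  shift-back : ∀ c₀ c → vecMat (c₀ ∷ c) (x ∷ R) ≡ vecMat ((c₀ +₄ z3 *₄ d c) ∷ c) (x ∷ map (addMultiple x t) R)
  shift-back c₀ c = trans (cong (λ a → vecMat (a ∷ c) (x ∷ R)) (sym (cancel c₀ (d c))))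
                          (sym (vecMat-addMultiple-pivot x t (c₀ +₄ z3 *₄ d c) c R))
    where
    cancel : ∀ a b → (a +₄ z3 *₄ b) +₄ b ≡ a
    cancel = decide₂ (λ a b → (a +₄ z3 *₄ b) +₄ b) (λ a b → a)
  forward : ∀ w → Span (x ∷ R) w → Span (x ∷ map (addMultiple x t) R) w
  forward w ((c₀ ∷ c) , eq) = ((c₀ +₄ z3 *₄ d c) ∷ c) , trans eq (shift-back c₀ c)
  backward : ∀ w → Span (x ∷ map (addMultiple x t) R) w → Span (x ∷ R) w
  backward w ((c₀ ∷ c) , eq) = ((c₀ +₄ d c) ∷ c) , trans eq (vecMat-addMultiple-pivot x t c₀ c R)

clear : Word (suc n) → (Word (suc n) → ℤ₄) → Matrix k (suc n) → Matrix k n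
clear x t R = map tail (map (addMultiple x t) R)

strip : {R : Matrix k (suc n)} → All (λ r → head r ≡ z0) R → R ≡ map (z0 ∷_) (map tail R)
strip [] = refl
strip {R = (a ∷ r) ∷ R} (refl ∷ ps) = cong ((z0 ∷ r) ∷_) (strip ps)

clear-strip : (x : Word (suc n)) (t : Word (suc n) → ℤ₄) {R : Matrix k (suc n)} →
  All (λ r → head (addMultiple x t r) ≡ z0) R → map (addMultiple x t) R ≡ map (z0 ∷_) (clear x t R)
clear-strip x t cleared = strip (map⁺ cleared)

head-addMultiple : (x r : Word (suc n)) (t : Word (suc n) → ℤ₄) → head (addMultiple x t r) ≡ head r +₄ t r *₄ head x
head-addMultiple (_ ∷ _) (_ ∷ _) t = refl

-- Row operations with pivot x preserve independence, provided the
-- multipliers of the even rows are even (so that those rows stay even).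
independent-addMultiple₄ : ∀ {k₁ k₂} (x : Word n) (t : Word n → ℤ₄) (gs : Matrix k₁ n) (hs : Matrix k₂ n) →
  All (λ h → In02 (t h)) hs → Independent (x ∷ gs) hs →
  Independent (x ∷ map (addMultiple x t) gs) (map (addMultiple x t) hs)
independent-addMultiple₄ x t gs hs t-even ind (c₀ ∷ c) z eq
  with ind ((c₀ +₄ dot (c ++ z) (map t (gs ++ hs))) ∷ c) z old-relation
  where
  old-relation = trans (sym (vecMat-addMultiple-pivot x t c₀ (c ++ z) (gs ++ hs)))
    (trans (cong (λ M → vecMat (c₀ ∷ (c ++ z)) (x ∷ M)) (map-++ (addMultiple x t) gs hs)) eq)
... | c-zero , z-even = cong₂ _∷_ c₀-zero c≡0 , z-even
  where
  c≡0 : c ≡ 0ᵛ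
  c≡0 = cong tail c-zero
  shift-zero : dot (c ++ z) (map t (gs ++ hs)) ≡ z0
  shift-zero = begin
    dot (c ++ z) (map t (gs ++ hs))           ≡⟨ cong (dot (c ++ z)) (map-++ t gs hs) ⟩
    dot (c ++ z) (map t gs ++ map t hs)       ≡⟨ dot-++ c z _ _ ⟩
    dot c (map t gs) +₄ dot z (map t hs)      ≡⟨ cong₂ _+₄_ (trans (cong (λ v → dot v (map t gs)) c≡0) (dot-zeroˡ (map t gs)))
                                                             (dot-even z-even (map⁺ t-even)) ⟩
    z0                                        ∎
    where open ≡-Reasoning
  c₀-zero : c₀ ≡ z0
  c₀-zero = trans (sym (+₄-identityʳ c₀)) (trans (cong (c₀ +₄_) (sym shift-zero)) (cong head c-zero))

independent-addMultiple₂ : ∀ {k₂} (x : Word n) (t : Word n → ℤ₄) (hs : Matrix k₂ n) →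
  Independent [] (x ∷ hs) → Independent [] (x ∷ map (addMultiple x t) hs)
independent-addMultiple₂ x t hs ind [] (c₀ ∷ z) eq
  with ind [] ((c₀ +₄ dot z (map t hs)) ∷ z) (trans (sym (vecMat-addMultiple-pivot x t c₀ z hs)) eq)
... | _ , (p ∷ z-even) = refl , (in02-cancel c₀ p (dot-evenˡ z-even _) ∷ z-even)

independent-strip₄ : ∀ {k₁ k₂} (y : Word (suc n)) (G : Matrix k₁ n) (H : Matrix k₂ n) →
  Independent (y ∷ map (z0 ∷_) G) (map (z0 ∷_) H) → Independent G H
independent-strip₄ y G H ind x z eq with ind (z0 ∷ x) z lifted
  where
  lifted : vecMat ((z0 ∷ x) ++ z) ((y ∷ map (z0 ∷_) G) ++ map (z0 ∷_) H) ≡ 0ᵛ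
  lifted = trans (cong₂ _+ᵛ_ (·ᵛ-zeroˡ y) (trans (cong (vecMat (x ++ z)) (sym (map-++ (z0 ∷_) G H)))
             (trans (vecMat-cons0 (x ++ z) (G ++ H)) (cong (z0 ∷_) eq)))) 0ᵛ+ᵛ0ᵛ
... | e , z-even = cong tail e , z-even

independent-strip₂ : ∀ {k₂} (y : Word (suc n)) (H : Matrix k₂ n) → Independent [] (y ∷ map (z0 ∷_) H) → Independent [] H
independent-strip₂ y H ind [] z eq
  with ind [] (z0 ∷ z) (trans (cong₂ _+ᵛ_ (·ᵛ-zeroˡ y) (trans (vecMat-cons0 z H) (cong (z0 ∷_) eq))) 0ᵛ+ᵛ0ᵛ)
... | _ , (_ ∷ z-even) = refl , z-even

-- Pivots.  An independent order-4 generator has a unit entry (otherwise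
-- 2 times it would vanish); an independent order-2 generator has an entry 2.

findUnit : (w : Word n) → (∃ λ p → Unit (lookup w p)) ⊎ Even w
findUnit [] = inj₂ []
findUnit (z1 ∷ w) = inj₁ (zero , inj₁ refl)
findUnit (z3 ∷ w) = inj₁ (zero , inj₂ refl)
findUnit (z0 ∷ w) = Sum.map (λ (p , u) → suc p , u) (inj₁ refl ∷_) (findUnit w)
findUnit (z2 ∷ w) = Sum.map (λ (p , u) → suc p , u) (inj₂ refl ∷_) (findUnit w)

findTwo : {w : Word n} → Even w → (∃ λ p → lookup w p ≡ z2) ⊎ (w ≡ 0ᵛ)
findTwo [] = inj₂ refl
findTwo (inj₂ refl ∷ e) = inj₁ (zero , refl)
findTwo (inj₁ refl ∷ e) = Sum.map (λ (p , q) → suc p , q) (cong (z0 ∷_)) (findTwo e)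

even-not-independent : ∀ {k₁ k₂} (g₀ : Word n) (gs : Matrix k₁ n) (hs : Matrix k₂ n) →
  Even g₀ → ¬ Independent (g₀ ∷ gs) hs
even-not-independent {n} {k₁} {k₂} g₀ gs hs ev ind with ind (z2 ∷ 0ᵛ {k₁}) (0ᵛ {k₂}) two-g₀
  where
  two-g₀ : vecMat ((z2 ∷ 0ᵛ {k₁}) ++ 0ᵛ {k₂}) ((g₀ ∷ gs) ++ hs) ≡ 0ᵛ
  two-g₀ = trans (cong₂ _+ᵛ_ (even-two ev) (trans (cong (λ v → vecMat v (gs ++ hs)) (sym (++-0ᵛ {k₁} {k₂})))
             (vecMat-zeroˡ (gs ++ hs)))) 0ᵛ+ᵛ0ᵛ
... | e , _ with cong head e
... | ()

zero-not-independent : ∀ {k₂} (hs : Matrix k₂ n) → ¬ Independent [] (0ᵛ ∷ hs)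
zero-not-independent hs ind with ind [] (z1 ∷ 0ᵛ) (trans (cong₂ _+ᵛ_ (·ᵛ-zeroʳ z1) (vecMat-zeroˡ hs)) 0ᵛ+ᵛ0ᵛ)
... | _ , (inj₁ () ∷ _)
... | _ , (inj₂ () ∷ _)

toFront : (p : Fin (suc n)) (u : ℤ₄) → Unit u → SignedPerm (suc n)
toFront p u u-unit = mkSignedPerm (P.transpose zero p) sign sign-unit
  where
  sign : Fin _ → ℤ₄
  sign zero = u
  sign (suc _) = z1
  sign-unit : ∀ j → Unit (sign j)
  sign-unit zero = u-unit
  sign-unit (suc _) = inj₁ refl

head-toFront : (p : Fin (suc n)) (u : ℤ₄) (u-unit : Unit u) (w : Word (suc n)) →
  head (act (toFront p u u-unit) w) ≡ u *₄ lookup w p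
head-toFront p u u-unit w = trans (head-lookup (act (toFront p u u-unit) w)) (lookup-act (toFront p u u-unit) w zero)
  where
  head-lookup : ∀ {A : Set} {n} (v : Vec A (suc n)) → head v ≡ lookup v zero
  head-lookup (x ∷ v) = refl

-- Back-substitution.  Every a ∈ ℤ₄ is low a + 2 · high a with both bits in
-- {0,1}; using this, any word is congruent modulo the code of G(A,B,D) to
-- a word (0, r, b) with r a (0,1)-vector.

In01 : ℤ₄ → Set
In01 a = a ≡ z0 ⊎ a ≡ z1

low : ℤ₄ → ℤ₄
low z0 = z0
low z1 = z1
low z2 = z0
low z3 = z1

high : ℤ₄ → ℤ₄
high z0 = z0
high z1 = z0
high z2 = z1
high z3 = z1

low-01 : ∀ a → In01 (low a)
low-01 z0 = inj₁ refl
low-01 z1 = inj₂ refl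
low-01 z2 = inj₁ refl
low-01 z3 = inj₂ refl

high-01 : ∀ a → In01 (high a)
high-01 z0 = inj₁ refl
high-01 z1 = inj₁ refl
high-01 z2 = inj₂ refl
high-01 z3 = inj₂ refl

low+2high : (u : Word n) → map low u +ᵛ (z2 ·ᵛ map high u) ≡ u
low+2high [] = refl
low+2high (z0 ∷ u) = cong (z0 ∷_) (low+2high u)
low+2high (z1 ∷ u) = cong (z1 ∷_) (low+2high u)
low+2high (z2 ∷ u) = cong (z2 ∷_) (low+2high u)
low+2high (z3 ∷ u) = cong (z3 ∷_) (low+2high u)

2high : {w : Word n} → Even w → z2 ·ᵛ map high w ≡ w
2high [] = refl
2high (inj₁ refl ∷ e) = cong (z0 ∷_) (2high e)
2high (inj₂ refl ∷ e) = cong (z2 ∷_) (2high e)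

map-01 : (f : ℤ₄ → ℤ₄) → (∀ a → In01 (f a)) → (u : Word n) (j : Fin n) → In01 (lookup (map f u) j)
map-01 f f-01 u j = subst In01 (sym (lookup-map j f u)) (f-01 _)

backsubstitute₄ : ∀ {k₁ k₂ ℓ} (A : Matrix k₁ k₂) (B : Matrix k₁ ℓ) (D : Matrix k₂ ℓ) (a : Word (k₁ + k₂ + ℓ)) →
  Σ (Word k₂) λ r → Σ (Word ℓ) λ b → Σ (Word (k₁ + k₂)) λ e →
    (∀ j → In01 (lookup r j)) × (a ≡ ((0ᵛ ++ r) ++ b) +ᵛ vecMat e (GMat A B D))
backsubstitute₄ {k₁} {k₂} A B D a with Data.Vec.splitAt (k₁ + k₂) a
... | a₁₂ , a₃ , refl with Data.Vec.splitAt k₁ a₁₂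
... | a₁ , a₂ , refl = r , b , (a₁ ++ q) , map-01 low low-01 u , sym eq
  where
  u = a₂ +ᵛ (z3 ·ᵛ vecMat a₁ A)
  r = map low u
  q = map high u
  b = a₃ +ᵛ (z3 ·ᵛ (vecMat a₁ B +ᵛ (z2 ·ᵛ vecMat q D)))
  open ≡-Reasoning
  middle : r +ᵛ (vecMat a₁ A +ᵛ (z2 ·ᵛ q)) ≡ a₂
  middle = begin
    r +ᵛ (vecMat a₁ A +ᵛ (z2 ·ᵛ q))   ≡⟨ cong (r +ᵛ_) (+ᵛ-comm _ _) ⟩
    r +ᵛ ((z2 ·ᵛ q) +ᵛ vecMat a₁ A)   ≡⟨ sym (+ᵛ-assoc r _ _) ⟩
    (r +ᵛ (z2 ·ᵛ q)) +ᵛ vecMat a₁ A   ≡⟨ cong (_+ᵛ vecMat a₁ A) (low+2high u) ⟩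
    u +ᵛ vecMat a₁ A                  ≡⟨ −+-cancel a₂ (vecMat a₁ A) ⟩
    a₂                                ∎
  eq : ((0ᵛ ++ r) ++ b) +ᵛ vecMat (a₁ ++ q) (GMat A B D) ≡ (a₁ ++ a₂) ++ a₃
  eq = begin
    ((0ᵛ ++ r) ++ b) +ᵛ vecMat (a₁ ++ q) (GMat A B D)
      ≡⟨ cong (((0ᵛ ++ r) ++ b) +ᵛ_) (vecMat-GMat A B D a₁ q) ⟩
    ((0ᵛ ++ r) ++ b) +ᵛ ((a₁ ++ (vecMat a₁ A +ᵛ (z2 ·ᵛ q))) ++ (vecMat a₁ B +ᵛ (z2 ·ᵛ vecMat q D)))
      ≡⟨ ++-+ᵛ (0ᵛ ++ r) (a₁ ++ (vecMat a₁ A +ᵛ (z2 ·ᵛ q))) b _ ⟩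
    ((0ᵛ ++ r) +ᵛ (a₁ ++ (vecMat a₁ A +ᵛ (z2 ·ᵛ q)))) ++ (b +ᵛ (vecMat a₁ B +ᵛ (z2 ·ᵛ vecMat q D)))
      ≡⟨ cong₂ _++_ (++-+ᵛ 0ᵛ a₁ r _) (−+-cancel a₃ _) ⟩
    ((0ᵛ +ᵛ a₁) ++ (r +ᵛ (vecMat a₁ A +ᵛ (z2 ·ᵛ q)))) ++ a₃
      ≡⟨ cong₂ (λ s t → (s ++ t) ++ a₃) (+ᵛ-identityˡ a₁) middle ⟩
    (a₁ ++ a₂) ++ a₃ ∎

backsubstitute₂ : ∀ {k₂ ℓ} (D : Matrix k₂ ℓ) (a : Word (k₂ + ℓ)) → Even a →
  Σ (Word ℓ) λ d → Σ (Word k₂) λ e →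
    (∀ j → In01 (lookup d j)) × (a ≡ (0ᵛ ++ (z2 ·ᵛ d)) +ᵛ vecMat e (GMat {0} [] [] D))
backsubstitute₂ {k₂} D a a-even with Data.Vec.splitAt k₂ a
... | a₂ , a₃ , refl = d , y , map-01 high high-01 v , sym eq
  where
  y = map high a₂
  v = a₃ +ᵛ (z3 ·ᵛ (z2 ·ᵛ vecMat y D))
  d = map high v
  a₂-even : Even a₂
  a₂-even = ++ˡ⁻ a₂ a-even
  v-even : Even v
  v-even = even-+ (++ʳ⁻ a₂ a-even) (even-·ʳ z3 (even-·ˡ (inj₂ refl) (vecMat y D)))
  open ≡-Reasoning
  eq : (0ᵛ ++ (z2 ·ᵛ d)) +ᵛ vecMat y (GMat {0} [] [] D) ≡ a₂ ++ a₃
  eq = begin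
    (0ᵛ ++ (z2 ·ᵛ d)) +ᵛ vecMat ([] ++ y) (GMat {0} [] [] D)
      ≡⟨ cong ((0ᵛ ++ (z2 ·ᵛ d)) +ᵛ_) (vecMat-GMat [] [] D [] y) ⟩
    (0ᵛ ++ (z2 ·ᵛ d)) +ᵛ ((0ᵛ +ᵛ (z2 ·ᵛ y)) ++ (0ᵛ +ᵛ (z2 ·ᵛ vecMat y D)))
      ≡⟨ ++-+ᵛ 0ᵛ _ (z2 ·ᵛ d) _ ⟩
    (0ᵛ +ᵛ (0ᵛ +ᵛ (z2 ·ᵛ y))) ++ ((z2 ·ᵛ d) +ᵛ (0ᵛ +ᵛ (z2 ·ᵛ vecMat y D)))
      ≡⟨ cong₂ _++_ (trans (+ᵛ-identityˡ _) (trans (+ᵛ-identityˡ _) (2high a₂-even)))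
                    (trans (cong₂ _+ᵛ_ (2high v-even) (+ᵛ-identityˡ _)) (−+-cancel a₃ _)) ⟩
    a₂ ++ a₃ ∎

cons0-∣∣ : ∀ {a b} (M : Matrix k a) (N : Matrix k b) → map (z0 ∷_) M ∣∣ N ≡ map (z0 ∷_) (M ∣∣ N)
cons0-∣∣ [] [] = refl
cons0-∣∣ (r ∷ M) (t ∷ N) = cong ((z0 ∷ (r ++ t)) ∷_) (cons0-∣∣ M N)

GMat-suc₄ : ∀ {k₁ k₂ ℓ} (r : Word k₂) (A : Matrix k₁ k₂) (b : Word ℓ) (B : Matrix k₁ ℓ) (D : Matrix k₂ ℓ) →
  GMat (r ∷ A) (b ∷ B) D ≡ (z1 ∷ ((0ᵛ ++ r) ++ b)) ∷ map (z0 ∷_) (GMat A B D)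
GMat-suc₄ {k₁} {k₂} r A b B D = begin
  GMat (r ∷ A) (b ∷ B) D
    ≡⟨ cong₂ (λ I Z → ((I ∣∣ (r ∷ A)) ∣∣ (b ∷ B)) ++ ((Z ∣∣ scaleMat z2 (idMat k₂)) ∣∣ scaleMat z2 D)) idMat-suc (zeroMat-suc k₂ k₁) ⟩
  (pivot ∷ ((map (z0 ∷_) (idMat k₁) ∣∣ A) ∣∣ B)) ++ ((map (z0 ∷_) (zeroMat k₂ k₁) ∣∣ scaleMat z2 (idMat k₂)) ∣∣ scaleMat z2 D)
    ≡⟨ cong₂ (λ X Y → pivot ∷ (X ++ Y)) (trans (cong (_∣∣ B) (cons0-∣∣ (idMat k₁) A)) (cons0-∣∣ _ B))
                                        (trans (cong (_∣∣ scaleMat z2 D) (cons0-∣∣ (zeroMat k₂ k₁) _)) (cons0-∣∣ _ _)) ⟩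
  pivot ∷ (map (z0 ∷_) ((idMat k₁ ∣∣ A) ∣∣ B) ++ map (z0 ∷_) ((zeroMat k₂ k₁ ∣∣ scaleMat z2 (idMat k₂)) ∣∣ scaleMat z2 D))
    ≡⟨ cong (pivot ∷_) (sym (map-++ (z0 ∷_) ((idMat k₁ ∣∣ A) ∣∣ B) _)) ⟩
  pivot ∷ map (z0 ∷_) (GMat A B D) ∎
  where
  open ≡-Reasoning
  pivot = z1 ∷ ((0ᵛ ++ r) ++ b)
  zeroMat-suc : ∀ k m → zeroMat k (suc m) ≡ map (z0 ∷_) (zeroMat k m)
  zeroMat-suc zero m = refl
  zeroMat-suc (suc k) m = cong ((z0 ∷ replicate m z0) ∷_) (zeroMat-suc k m)

GMat-suc₂ : ∀ {k₂ ℓ} (d : Word ℓ) (D : Matrix k₂ ℓ) →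
  GMat {0} {suc k₂} [] [] (d ∷ D) ≡ (z2 ∷ (0ᵛ ++ (z2 ·ᵛ d))) ∷ map (z0 ∷_) (GMat {0} {k₂} [] [] D)
GMat-suc₂ {k₂} d D = begin
  GMat {0} {suc k₂} [] [] (d ∷ D)
    ≡⟨ cong (λ I → (zeroMat (suc k₂) 0 ∣∣ scaleMat z2 I) ∣∣ scaleMat z2 (d ∷ D)) idMat-suc ⟩
  ((z2 ∷ (z2 ·ᵛ 0ᵛ)) ++ (z2 ·ᵛ d)) ∷ ((zeroMat k₂ 0 ∣∣ scaleMat z2 (map (z0 ∷_) (idMat k₂))) ∣∣ scaleMat z2 D)
    ≡⟨ cong₂ (λ u X → (z2 ∷ (u ++ (z2 ·ᵛ d))) ∷ X) (·ᵛ-zeroʳ z2)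
             (cong (λ S → (zeroMat k₂ 0 ∣∣ S) ∣∣ scaleMat z2 D) (scale-cons0 (idMat k₂))) ⟩
  (z2 ∷ (0ᵛ ++ (z2 ·ᵛ d))) ∷ ((zeroMat k₂ 0 ∣∣ map (z0 ∷_) (scaleMat z2 (idMat k₂))) ∣∣ scaleMat z2 D)
    ≡⟨ cong ((z2 ∷ (0ᵛ ++ (z2 ·ᵛ d))) ∷_) (trans (cong (_∣∣ scaleMat z2 D) (empty-∣∣ (scaleMat z2 (idMat k₂)))) (cons0-∣∣ _ _)) ⟩
  (z2 ∷ (0ᵛ ++ (z2 ·ᵛ d))) ∷ map (z0 ∷_) (GMat {0} {k₂} [] [] D) ∎
  where
  open ≡-Reasoning
  empty-∣∣ : ∀ {k a} (M : Matrix k a) → zeroMat k 0 ∣∣ map (z0 ∷_) M ≡ map (z0 ∷_) (zeroMat k 0 ∣∣ M)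
  empty-∣∣ [] = refl
  empty-∣∣ (r ∷ M) = cong ((z0 ∷ r) ∷_) (empty-∣∣ M)
  scale-cons0 : ∀ {k n} (M : Matrix k n) → scaleMat z2 (map (z0 ∷_) M) ≡ map (z0 ∷_) (scaleMat z2 M)
  scale-cons0 [] = refl
  scale-cons0 (r ∷ M) = cong ((z0 ∷ (z2 ·ᵛ r)) ∷_) (scale-cons0 M)

lift : SignedPerm n → SignedPerm (suc n)
lift σ = idSP {1} ⊕ σ

act-lift : (σ : SignedPerm n) (h : ℤ₄) (t : Word n) → act (lift σ) (h ∷ t) ≡ h ∷ act σ t
act-lift σ h t = trans (act-⊕ idSP σ (h ∷ []) t) (cong (_++ act σ t) (act-id (h ∷ [])))

act-inv-lift : (σ : SignedPerm n) (h : ℤ₄) (t : Word n) → act (inv (lift σ)) (h ∷ t) ≡ h ∷ act (inv σ) t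
act-inv-lift σ h t = inv-unique (lift σ) (trans (act-lift σ h (act (inv σ) t)) (cong (h ∷_) (act-act-inv σ t)))

vecMat-pivot : (c₀ h : ℤ₄) (c : Word k) (a : Word n) (R : Matrix k n) →
  vecMat (c₀ ∷ c) ((h ∷ a) ∷ map (z0 ∷_) R) ≡ (c₀ *₄ h) ∷ ((c₀ ·ᵛ a) +ᵛ vecMat c R)
vecMat-pivot c₀ h c a R = trans (cong ((c₀ ·ᵛ (h ∷ a)) +ᵛ_) (vecMat-cons0 c R)) (cong (_∷ _) (+₄-identityʳ (c₀ *₄ h)))

carries-lift : ∀ {k'} (h : ℤ₄) (a top : Word n) (T : Matrix k n) (G : Matrix k' n) (σ : SignedPerm n) →
  Carries σ (Span T) (Span G) → (e : Word k') → act σ a ≡ top +ᵛ vecMat e G →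
  Carries (lift σ) (Span ((h ∷ a) ∷ map (z0 ∷_) T)) (Span ((h ∷ top) ∷ map (z0 ∷_) G))
carries-lift h a top T G σ (σ→ , σ←) e a≡ = forward , backward
  where
  open ≡-Reasoning
  forward : ∀ w → Span ((h ∷ a) ∷ map (z0 ∷_) T) w → Span ((h ∷ top) ∷ map (z0 ∷_) G) (act (lift σ) w)
  forward w ((c₀ ∷ c) , refl) with σ→ (vecMat c T) (c , refl)
  ... | c' , c'-eq = (c₀ ∷ ((c₀ ·ᵛ e) +ᵛ c')) , (begin
    act (lift σ) (vecMat (c₀ ∷ c) ((h ∷ a) ∷ map (z0 ∷_) T))    ≡⟨ cong (act (lift σ)) (vecMat-pivot c₀ h c a T) ⟩
    act (lift σ) ((c₀ *₄ h) ∷ ((c₀ ·ᵛ a) +ᵛ vecMat c T))        ≡⟨ act-lift σ _ _ ⟩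
    (c₀ *₄ h) ∷ act σ ((c₀ ·ᵛ a) +ᵛ vecMat c T)                 ≡⟨ cong ((c₀ *₄ h) ∷_) tail-eq ⟩
    (c₀ *₄ h) ∷ ((c₀ ·ᵛ top) +ᵛ vecMat ((c₀ ·ᵛ e) +ᵛ c') G)     ≡⟨ sym (vecMat-pivot c₀ h ((c₀ ·ᵛ e) +ᵛ c') top G) ⟩
    vecMat (c₀ ∷ ((c₀ ·ᵛ e) +ᵛ c')) ((h ∷ top) ∷ map (z0 ∷_) G) ∎)
    where
    tail-eq : act σ ((c₀ ·ᵛ a) +ᵛ vecMat c T) ≡ (c₀ ·ᵛ top) +ᵛ vecMat ((c₀ ·ᵛ e) +ᵛ c') G
    tail-eq = begin
      act σ ((c₀ ·ᵛ a) +ᵛ vecMat c T)                     ≡⟨ act-+ σ _ _ ⟩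
      act σ (c₀ ·ᵛ a) +ᵛ act σ (vecMat c T)               ≡⟨ cong₂ _+ᵛ_ (trans (act-· σ c₀ a) (cong (c₀ ·ᵛ_) a≡)) c'-eq ⟩
      (c₀ ·ᵛ (top +ᵛ vecMat e G)) +ᵛ vecMat c' G          ≡⟨ cong (_+ᵛ vecMat c' G) (·ᵛ-distribˡ c₀ top _) ⟩
      ((c₀ ·ᵛ top) +ᵛ (c₀ ·ᵛ vecMat e G)) +ᵛ vecMat c' G  ≡⟨ +ᵛ-assoc _ _ _ ⟩
      (c₀ ·ᵛ top) +ᵛ ((c₀ ·ᵛ vecMat e G) +ᵛ vecMat c' G)  ≡⟨ cong ((c₀ ·ᵛ top) +ᵛ_) (sym (trans (vecMat-+ (c₀ ·ᵛ e) c' G) (cong (_+ᵛ vecMat c' G) (vecMat-· c₀ e G)))) ⟩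
      (c₀ ·ᵛ top) +ᵛ vecMat ((c₀ ·ᵛ e) +ᵛ c') G           ∎
  backward : ∀ w → Span ((h ∷ top) ∷ map (z0 ∷_) G) w → Span ((h ∷ a) ∷ map (z0 ∷_) T) (act (inv (lift σ)) w)
  backward w ((c₀ ∷ c) , refl) with σ← _ (c +ᵛ ((z3 *₄ c₀) ·ᵛ e) , refl)
  ... | c' , c'-eq = (c₀ ∷ c') , (begin
    act (inv (lift σ)) (vecMat (c₀ ∷ c) ((h ∷ top) ∷ map (z0 ∷_) G))   ≡⟨ cong (act (inv (lift σ))) (vecMat-pivot c₀ h c top G) ⟩
    act (inv (lift σ)) ((c₀ *₄ h) ∷ ((c₀ ·ᵛ top) +ᵛ vecMat c G))       ≡⟨ act-inv-lift σ _ _ ⟩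
    (c₀ *₄ h) ∷ act (inv σ) ((c₀ ·ᵛ top) +ᵛ vecMat c G)                ≡⟨ cong (λ t → (c₀ *₄ h) ∷ act (inv σ) t) regroup ⟩
    (c₀ *₄ h) ∷ act (inv σ) (act σ (c₀ ·ᵛ a) +ᵛ vecMat c″ G)           ≡⟨ cong ((c₀ *₄ h) ∷_) (act-+ (inv σ) _ _) ⟩
    (c₀ *₄ h) ∷ (act (inv σ) (act σ (c₀ ·ᵛ a)) +ᵛ act (inv σ) (vecMat c″ G)) ≡⟨ cong ((c₀ *₄ h) ∷_) (cong₂ _+ᵛ_ (act-inv-act σ _) c'-eq) ⟩
    (c₀ *₄ h) ∷ ((c₀ ·ᵛ a) +ᵛ vecMat c' T)                             ≡⟨ sym (vecMat-pivot c₀ h c' a T) ⟩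
    vecMat (c₀ ∷ c') ((h ∷ a) ∷ map (z0 ∷_) T) ∎)
    where
    c″ = c +ᵛ ((z3 *₄ c₀) ·ᵛ e)
    eG = vecMat e G
    -- c₀ top + c G = c₀ (σ a - e G) + c G = σ (c₀ a) + (c - c₀ e) G
    regroup : (c₀ ·ᵛ top) +ᵛ vecMat c G ≡ act σ (c₀ ·ᵛ a) +ᵛ vecMat c″ G
    regroup = begin
      (c₀ ·ᵛ top) +ᵛ vecMat c G
        ≡⟨ cong (_+ᵛ vecMat c G) (sym (+ᵛ-identityʳ _)) ⟩
      ((c₀ ·ᵛ top) +ᵛ 0ᵛ) +ᵛ vecMat c G
        ≡⟨ cong (λ t → ((c₀ ·ᵛ top) +ᵛ t) +ᵛ vecMat c G) (sym (trans (sym (·ᵛ-distribˡ c₀ _ _)) (trans (cong (c₀ ·ᵛ_) (+ᵛ-inverseʳ eG)) (·ᵛ-zeroʳ c₀)))) ⟩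
      ((c₀ ·ᵛ top) +ᵛ ((c₀ ·ᵛ eG) +ᵛ (c₀ ·ᵛ (z3 ·ᵛ eG)))) +ᵛ vecMat c G
        ≡⟨ cong (_+ᵛ vecMat c G) (sym (+ᵛ-assoc _ _ _)) ⟩
      (((c₀ ·ᵛ top) +ᵛ (c₀ ·ᵛ eG)) +ᵛ (c₀ ·ᵛ (z3 ·ᵛ eG))) +ᵛ vecMat c G
        ≡⟨ +ᵛ-assoc _ _ _ ⟩
      ((c₀ ·ᵛ top) +ᵛ (c₀ ·ᵛ eG)) +ᵛ ((c₀ ·ᵛ (z3 ·ᵛ eG)) +ᵛ vecMat c G)
        ≡⟨ cong₂ _+ᵛ_ (trans (sym (·ᵛ-distribˡ c₀ _ _)) (cong (c₀ ·ᵛ_) (sym a≡))) (trans (+ᵛ-comm _ _) (cong (vecMat c G +ᵛ_) minus-c₀e)) ⟩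
      (c₀ ·ᵛ act σ a) +ᵛ (vecMat c G +ᵛ vecMat ((z3 *₄ c₀) ·ᵛ e) G)
        ≡⟨ cong₂ _+ᵛ_ (sym (act-· σ c₀ a)) (sym (vecMat-+ c _ G)) ⟩
      act σ (c₀ ·ᵛ a) +ᵛ vecMat c″ G ∎
      where
      minus-c₀e : c₀ ·ᵛ (z3 ·ᵛ eG) ≡ vecMat ((z3 *₄ c₀) ·ᵛ e) G
      minus-c₀e = trans (sym (·ᵛ-assoc c₀ z3 _)) (trans (cong (_·ᵛ eG) (*₄-comm c₀ z3)) (sym (vecMat-· (z3 *₄ c₀) e G)))

-- For an independent family whose first generator
-- has order 4: move a unit entry of it to the front as a 1, clear the rest
-- of the first column, and drop the pivot row and column; what remains is
-- again an independent family with even order-2 part.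

record Pivoted₄ {k₁ k₂} (gs : Matrix (suc k₁) (suc n)) (hs : Matrix k₂ (suc n)) : Set where
  field
    τ : SignedPerm (suc n)
    rest : Word n
    gs' : Matrix k₁ n
    hs' : Matrix k₂ n
    hs'-even : AllEven hs'
    independent : Independent gs' hs'
    carries : Carries τ (Span (gs ++ hs)) (Span ((z1 ∷ rest) ∷ map (z0 ∷_) (gs' ++ hs')))

pivot₄ : ∀ {k₁ k₂} (g₀ : Word (suc n)) (gs : Matrix k₁ (suc n)) (hs : Matrix k₂ (suc n)) →
  AllEven hs → Independent (g₀ ∷ gs) hs → Pivoted₄ (g₀ ∷ gs) hs
pivot₄ g₀ gs hs hs-even ind with findUnit g₀
... | inj₂ g₀-even = ⊥-elim (even-not-independent g₀ gs hs g₀-even ind)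
... | inj₁ (p , u-unit) = record
  { τ = τ ⨾ idSP ; rest = tail g₁ ; gs' = clear g₁ t gs₁ ; hs' = clear g₁ t hs₁
  ; hs'-even = map⁺ (map⁺ (All.map (λ e → even-tail (even-+ e (even-·ˡ (t-even e) g₁))) hs₁-even))
  ; independent = independent-strip₄ g₁ (clear g₁ t gs₁) (clear g₁ t hs₁) (subst₂ (λ X Y → Independent (g₁ ∷ X) Y) gs-cleared hs-cleared
      (independent-addMultiple₄ g₁ t gs₁ hs₁ (All.map t-even hs₁-even) (independent-act τ (g₀ ∷ gs) hs ind)))
  ; carries = carries-⨾ (retarget permuted (carries-span τ ((g₀ ∷ gs) ++ hs)))
                        (retarget eliminated (carries-addMultiple g₁ t (gs₁ ++ hs₁)))
  }
  where
  τ = toFront p (lookup g₀ p) u-unit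
  g₁ = act τ g₀
  gs₁ = map (act τ) gs
  hs₁ = map (act τ) hs
  hs₁-even : AllEven hs₁
  hs₁-even = map⁺ (All.map (even-act τ) hs-even)
  g₁-head : head g₁ ≡ z1
  g₁-head = trans (head-toFront p _ u-unit g₀) (unit-square u-unit)
    where
    unit-square : ∀ {u} → Unit u → u *₄ u ≡ z1
    unit-square (inj₁ refl) = refl
    unit-square (inj₂ refl) = refl
  g₁≡ : g₁ ≡ z1 ∷ tail g₁
  g₁≡ = trans (η g₁) (cong (_∷ tail g₁) g₁-head)
    where
    η : ∀ {m} (v : Word (suc m)) → v ≡ head v ∷ tail v
    η (_ ∷ _) = refl
  -- subtract (head r) times the pivot row from r
  t : Word _ → ℤ₄
  t r = z3 *₄ head r
  t-even : ∀ {h} → Even h → In02 (t h)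
  t-even (q ∷ _) = in02-*ʳ z3 q
  cleared : ∀ r → head (addMultiple g₁ t r) ≡ z0
  cleared r = trans (head-addMultiple g₁ r t) (trans (cong (λ c → head r +₄ t r *₄ c) g₁-head)
    (decide₁ (λ a → a +₄ (z3 *₄ a) *₄ z1) (λ _ → z0) (head r)))
  gs-cleared = clear-strip g₁ t (All.universal cleared gs₁)
  hs-cleared = clear-strip g₁ t (All.universal cleared hs₁)
  permuted : map (act τ) ((g₀ ∷ gs) ++ hs) ≡ g₁ ∷ (gs₁ ++ hs₁)
  permuted = cong (g₁ ∷_) (map-++ (act τ) gs hs)
  eliminated : g₁ ∷ map (addMultiple g₁ t) (gs₁ ++ hs₁) ≡ (z1 ∷ tail g₁) ∷ map (z0 ∷_) (clear g₁ t gs₁ ++ clear g₁ t hs₁)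
  eliminated = cong₂ _∷_ g₁≡ (trans (map-++ (addMultiple g₁ t) gs₁ hs₁)
    (trans (cong₂ _++_ gs-cleared hs-cleared) (sym (map-++ (z0 ∷_) (clear g₁ t gs₁) (clear g₁ t hs₁)))))

-- The same step for an order-2 generator (once no order-4 generators are
-- left): move an entry 2 to the front and clear the first column.

record Pivoted₂ {k₂} (hs : Matrix (suc k₂) (suc n)) : Set where
  field
    τ : SignedPerm (suc n)
    rest : Word n
    rest-even : Even rest
    hs' : Matrix k₂ n
    hs'-even : AllEven hs'
    independent : Independent [] hs'
    carries : Carries τ (Span hs) (Span ((z2 ∷ rest) ∷ map (z0 ∷_) hs'))

pivot₂ : ∀ {k₂} (h₀ : Word (suc n)) (hs : Matrix k₂ (suc n)) →
  Even h₀ → AllEven hs → Independent [] (h₀ ∷ hs) → Pivoted₂ (h₀ ∷ hs)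
pivot₂ h₀ hs h₀-even hs-even ind with findTwo h₀-even
... | inj₂ h₀≡0 = ⊥-elim (zero-not-independent hs (subst (λ v → Independent [] (v ∷ hs)) h₀≡0 ind))
... | inj₁ (p , is-two) = record
  { τ = τ ⨾ idSP ; rest = tail h₁ ; rest-even = even-tail h₁-even ; hs' = clear h₁ t hs₁
  ; hs'-even = map⁺ (map⁺ (All.map (λ {r} e → even-tail (even-+ e (even-·ʳ (t r) h₁-even))) hs₁-even))
  ; independent = independent-strip₂ h₁ (clear h₁ t hs₁) (subst (λ Y → Independent [] (h₁ ∷ Y)) hs-cleared
      (independent-addMultiple₂ h₁ t hs₁ (independent-act τ [] (h₀ ∷ hs) ind)))
  ; carries = carries-⨾ (carries-span τ (h₀ ∷ hs))
                        (retarget eliminated (carries-addMultiple h₁ t hs₁))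
  }
  where
  τ = toFront p z1 (inj₁ refl)
  h₁ = act τ h₀
  hs₁ = map (act τ) hs
  h₁-even : Even h₁
  h₁-even = even-act τ h₀-even
  hs₁-even : AllEven hs₁
  hs₁-even = map⁺ (All.map (even-act τ) hs-even)
  h₁-head : head h₁ ≡ z2
  h₁-head = trans (head-toFront p z1 (inj₁ refl) h₀) (trans (*₄-identityˡ _) is-two)
  h₁≡ : h₁ ≡ z2 ∷ tail h₁
  h₁≡ = trans (η h₁) (cong (_∷ tail h₁) h₁-head)
    where
    η : ∀ {m} (v : Word (suc m)) → v ≡ head v ∷ tail v
    η (_ ∷ _) = refl
  -- subtract (head r / 2) times the pivot row from the even row r
  t : Word _ → ℤ₄
  t r = z3 *₄ high (head r)
  cleared : ∀ {r} → Even r → head (addMultiple h₁ t r) ≡ z0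
  cleared {r} (q ∷ _) = trans (head-addMultiple h₁ r t) (trans (cong (λ c → head r +₄ t r *₄ c) h₁-head) (halve q))
    where
    halve : ∀ {a} → In02 a → a +₄ (z3 *₄ high a) *₄ z2 ≡ z0
    halve (inj₁ refl) = refl
    halve (inj₂ refl) = refl
  hs-cleared = clear-strip h₁ t (All.map cleared hs₁-even)
  eliminated : h₁ ∷ map (addMultiple h₁ t) hs₁ ≡ (z2 ∷ tail h₁) ∷ map (z0 ∷_) (clear h₁ t hs₁)
  eliminated = cong₂ _∷_ h₁≡ hs-cleared

-- Repeating the elimination step and back-substituting
-- each pivot row, an independent family (gs ; hs) with hs even is carried
-- by a signed permutation onto the rows of some G(A,B,D) with A and D
-- (0,1)-matrices.

entries01-∷ : {r : Word n} {M : Matrix k n} → (∀ j → In01 (lookup r j)) → EntriesIn01 M → EntriesIn01 (r ∷ M)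
entries01-∷ r-01 M-01 zero j = r-01 j
entries01-∷ r-01 M-01 (suc i) j = M-01 i j

standardForm₂ : ∀ k₂ ℓ (hs : Matrix k₂ (k₂ + ℓ)) → AllEven hs → Independent [] hs →
  Σ (SignedPerm (k₂ + ℓ)) λ σ → Σ (Matrix k₂ ℓ) λ D →
    EntriesIn01 D × Carries σ (Span hs) (Span (GMat {0} [] [] D))
standardForm₂ zero ℓ [] _ _ = idSP , [] , (λ ()) , carries-id (λ _ p → p) (λ _ p → p)
standardForm₂ (suc k₂) ℓ (h₀ ∷ hs) (h₀-even ∷ hs-even) ind =
  τ ⨾ lift σ , d ∷ D , entries01-∷ d-01 D-01 ,
  carries-⨾ carries (retarget (sym (GMat-suc₂ d D))
                           (carries-lift z2 rest _ hs' _ σ σ-carries e rest≡))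
  where
  open Pivoted₂ (pivot₂ h₀ hs h₀-even hs-even ind)
  recursive = standardForm₂ k₂ ℓ hs' hs'-even independent
  σ = proj₁ recursive
  D = proj₁ (proj₂ recursive)
  D-01 = proj₁ (proj₂ (proj₂ recursive))
  σ-carries = proj₂ (proj₂ (proj₂ recursive))
  substituted = backsubstitute₂ D (act σ rest) (even-act σ rest-even)
  d = proj₁ substituted
  e = proj₁ (proj₂ substituted)
  d-01 = proj₁ (proj₂ (proj₂ substituted))
  rest≡ = proj₂ (proj₂ (proj₂ substituted))

record StandardForm (k₁ k₂ ℓ : ℕ) (M : Matrix (k₁ + k₂) (k₁ + k₂ + ℓ)) : Set where
  field
    σ : SignedPerm (k₁ + k₂ + ℓ)
    A : Matrix k₁ k₂
    B : Matrix k₁ ℓ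
    D : Matrix k₂ ℓ
    A-01 : EntriesIn01 A
    D-01 : EntriesIn01 D
    carries : Carries σ (Span M) (Span (GMat A B D))

standardForm : ∀ k₁ k₂ ℓ (gs : Matrix k₁ (k₁ + k₂ + ℓ)) (hs : Matrix k₂ (k₁ + k₂ + ℓ)) →
  AllEven hs → Independent gs hs → StandardForm k₁ k₂ ℓ (gs ++ hs)
standardForm zero k₂ ℓ [] hs hs-even ind with standardForm₂ k₂ ℓ hs hs-even ind
... | σ , D , D-01 , σ-carries =
  record { σ = σ ; A = [] ; B = [] ; D = D ; A-01 = λ () ; D-01 = D-01 ; carries = σ-carries }
standardForm (suc k₁) k₂ ℓ (g₀ ∷ gs) hs hs-even ind = record
  { σ = τ ⨾ lift R.σ ; A = r ∷ R.A ; B = b ∷ R.B ; D = R.D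
  ; A-01 = entries01-∷ r-01 R.A-01 ; D-01 = R.D-01
  ; carries = carries-⨾ carries (retarget (sym (GMat-suc₄ r R.A b R.B R.D))
                                   (carries-lift z1 rest _ (gs' ++ hs') _ R.σ R.carries e rest≡))
  }
  where
  open Pivoted₄ (pivot₄ g₀ gs hs hs-even ind)
  module R = StandardForm (standardForm k₁ k₂ ℓ gs' hs' hs'-even independent)
  substituted = backsubstitute₄ R.A R.B R.D (act R.σ rest)
  r = proj₁ substituted
  b = proj₁ (proj₂ substituted)
  e = proj₁ (proj₂ (proj₂ substituted))
  r-01 = proj₁ (proj₂ (proj₂ (proj₂ substituted)))
  rest≡ = proj₂ (proj₂ (proj₂ (proj₂ substituted)))

lex-refl : (u : Word n) → u ≤ˡᵉˣ u
lex-refl [] = tt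
lex-refl (x ∷ u) = inj₂ (refl , lex-refl u)

lex-trans : (u v w : Word n) → u ≤ˡᵉˣ v → v ≤ˡᵉˣ w → u ≤ˡᵉˣ w
lex-trans [] [] [] _ _ = tt
lex-trans (x ∷ u) (y ∷ v) (z ∷ w) (inj₁ p) (inj₁ q) = inj₁ (ℕ.<-trans p q)
lex-trans (x ∷ u) (y ∷ v) (z ∷ w) (inj₁ p) (inj₂ (refl , _)) = inj₁ p
lex-trans (x ∷ u) (y ∷ v) (z ∷ w) (inj₂ (refl , _)) (inj₁ q) = inj₁ q
lex-trans (x ∷ u) (y ∷ v) (z ∷ w) (inj₂ (refl , p)) (inj₂ (refl , q)) = inj₂ (refl , lex-trans u v w p q)

lex-total : (u v : Word n) → u ≤ˡᵉˣ v ⊎ v ≤ˡᵉˣ u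
lex-total [] [] = inj₁ tt
lex-total (x ∷ u) (y ∷ v) with ℕ.<-cmp (toℕ₄ x) (toℕ₄ y)
... | tri< p _ _ = inj₁ (inj₁ p)
... | tri> _ _ p = inj₂ (inj₁ p)
... | tri≈ _ e _ with toℕ₄-injective {x} {y} e
...   | refl = Sum.map (λ p → inj₂ (refl , p)) (λ p → inj₂ (refl , p)) (lex-total u v)

minimum : (v : Fin (suc k) → Word m) → Σ (Fin (suc k)) λ i₀ → ∀ i → v i₀ ≤ˡᵉˣ v i
minimum {zero} v = zero , λ { zero → lex-refl (v zero) }
minimum {suc k} v with minimum (λ i → v (suc i))
... | i₁ , i₁-min with lex-total (v zero) (v (suc i₁))
...   | inj₁ q = zero , λ { zero → lex-refl (v zero) ; (suc i) → lex-trans (v zero) _ _ q (i₁-min i) }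
...   | inj₂ q = suc i₁ , λ { zero → q ; (suc i) → i₁-min i }

SortedBy : (Fin k → Word m) → Permutation′ k → Set
SortedBy {k} v ρ = ∀ (i j : Fin k) → i ≤ᶠ j → v (ρ ⟨$⟩ʳ i) ≤ˡᵉˣ v (ρ ⟨$⟩ʳ j)

sort : (v : Fin k → Word m) → Σ (Permutation′ k) (SortedBy v)
sort {zero} v = P.id , λ ()
sort {suc k} v with minimum v
... | i₀ , i₀-min with sort (λ i → v (P.transpose zero i₀ ⟨$⟩ʳ suc i))
...   | ρ , ρ-sorted = P.lift₀ ρ P.∘ₚ P.transpose zero i₀ , sorted
  where
  sorted : SortedBy v (P.lift₀ ρ P.∘ₚ P.transpose zero i₀)
  sorted zero j _ = i₀-min _
  sorted (suc i) (suc j) (s≤s le) = ρ-sorted i j le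

-- Permuting the coefficients and the rows of a matrix alike does not
-- change the combination: both are the same finite sum, reordered.

WordMonoid : ℕ → CommutativeMonoid _ _
WordMonoid n = record
  { Carrier = Word n ; _≈_ = _≡_ ; _∙_ = _+ᵛ_ ; ε = 0ᵛ
  ; isCommutativeMonoid = record
    { isMonoid = record
      { isSemigroup = record { isMagma = record { isEquivalence = isEquivalence ; ∙-cong = cong₂ _+ᵛ_ } ; assoc = +ᵛ-assoc }
      ; identity = +ᵛ-identityˡ , +ᵛ-identityʳ }
    ; comm = +ᵛ-comm } }

module WordSum {m} = MonoidSum (WordMonoid m)

vecMat-sum : (c : Word k) (M : Matrix k m) → vecMat c M ≡ WordSum.sum (λ i → lookup c i ·ᵛ lookup M i)
vecMat-sum [] [] = refl
vecMat-sum (a ∷ c) (r ∷ M) = cong ((a ·ᵛ r) +ᵛ_) (vecMat-sum c M)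

permuteRows : Permutation′ k → Matrix k m → Matrix k m
permuteRows ρ M = tabulate (λ r → lookup M (ρ ⟨$⟩ʳ r))

vecMat-permuteRows : (ρ : Permutation′ k) (x : Word k) (M : Matrix k m) →
  vecMat (act (unsigned ρ) x) (permuteRows ρ M) ≡ vecMat x M
vecMat-permuteRows ρ x M = begin
  vecMat (act (unsigned ρ) x) (permuteRows ρ M)
    ≡⟨ vecMat-sum (act (unsigned ρ) x) (permuteRows ρ M) ⟩
  WordSum.sum (λ i → lookup (act (unsigned ρ) x) i ·ᵛ lookup (permuteRows ρ M) i)
    ≡⟨ WordSum.sum-cong-≗ (λ i → cong₂ _·ᵛ_ (lookup-unsigned ρ x i) (lookup∘tabulate _ i)) ⟩
  WordSum.sum (λ i → lookup x (ρ ⟨$⟩ʳ i) ·ᵛ lookup M (ρ ⟨$⟩ʳ i))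
    ≡⟨ sym (WordSum.sum-permute (λ i → lookup x i ·ᵛ lookup M i) ρ) ⟩
  WordSum.sum (λ i → lookup x i ·ᵛ lookup M i)
    ≡⟨ sym (vecMat-sum x M) ⟩
  vecMat x M ∎
  where open ≡-Reasoning

entry-map-act : (σ : SignedPerm n) (M : Matrix k n) (i : Fin k) (j : Fin n) →
  entry (map (act σ) M) i j ≡ s σ j *₄ entry M i (π σ ⟨$⟩ʳ j)
entry-map-act σ M i j = trans (cong (λ r → lookup r j) (lookup-map i (act σ) M)) (lookup-act σ _ j)

-- Normalisation (i) of the paper: sort the rows of A.  Permuting the
-- first k₁ coordinates like the rows of A (and of B) keeps the shape
-- G(A,B,D), with x replaced by its permutation.
sortRowsOfA : ∀ {k₁ k₂ ℓ} (A : Matrix k₁ k₂) (B : Matrix k₁ ℓ) (D : Matrix k₂ ℓ) → EntriesIn01 A →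
  Σ (SignedPerm (k₁ + k₂ + ℓ)) λ τ → Σ (Matrix k₁ k₂) λ A' → Σ (Matrix k₁ ℓ) λ B' →
    EntriesIn01 A' × RowSorted A' × Carries τ (Span (GMat A B D)) (Span (GMat A' B' D))
sortRowsOfA {k₁} {k₂} {ℓ} A B D A-01 =
  τ , A' , B' , A'-01 , A'-sorted , carries-GMat τ (act ρ̂) (act (inv ρ̂)) (act-act-inv ρ̂) on-gwords
  where
  ρ = proj₁ (sort (lookup A))
  ρ̂ = unsigned ρ
  τ = (ρ̂ ⊕ idSP {k₂}) ⊕ idSP {ℓ}
  A' = permuteRows ρ A
  B' = permuteRows ρ B
  A'-01 : EntriesIn01 A'
  A'-01 i j = subst (λ r → In01 (lookup r j)) (sym (lookup∘tabulate _ i)) (A-01 (ρ ⟨$⟩ʳ i) j)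
  A'-sorted : RowSorted A'
  A'-sorted i j le = subst₂ _≤ˡᵉˣ_ (sym (lookup∘tabulate _ i)) (sym (lookup∘tabulate _ j)) (proj₂ (sort (lookup A)) i j le)
  on-gwords : ∀ x y → act τ (gword A B D x y) ≡ gword A' B' D (act ρ̂ x) y
  on-gwords x y = begin
    act τ ((x ++ (vecMat x A +ᵛ (z2 ·ᵛ y))) ++ (vecMat x B +ᵛ (z2 ·ᵛ vecMat y D)))
      ≡⟨ act-⊕ (ρ̂ ⊕ idSP) idSP _ _ ⟩
    act (ρ̂ ⊕ idSP) (x ++ (vecMat x A +ᵛ (z2 ·ᵛ y))) ++ act idSP (vecMat x B +ᵛ (z2 ·ᵛ vecMat y D))
      ≡⟨ cong₂ _++_ (act-⊕ ρ̂ idSP _ _) (act-id _) ⟩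
    (act ρ̂ x ++ act idSP (vecMat x A +ᵛ (z2 ·ᵛ y))) ++ (vecMat x B +ᵛ (z2 ·ᵛ vecMat y D))
      ≡⟨ cong₂ (λ u v → (act ρ̂ x ++ u) ++ v)
               (trans (act-id _) (cong (_+ᵛ (z2 ·ᵛ y)) (sym (vecMat-permuteRows ρ x A))))
               (cong (_+ᵛ (z2 ·ᵛ vecMat y D)) (sym (vecMat-permuteRows ρ x B))) ⟩
    gword A' B' D (act ρ̂ x) y ∎
    where open ≡-Reasoning

act-last : ∀ {k₁ k₂ ℓ} (ν : SignedPerm ℓ) (A : Matrix k₁ k₂) (B : Matrix k₁ ℓ) (D : Matrix k₂ ℓ) x y →
  act (idSP {k₁ + k₂} ⊕ ν) (gword A B D x y) ≡ gword A (map (act ν) B) (map (act ν) D) x y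
act-last ν A B D x y = begin
  act (idSP ⊕ ν) ((x ++ (vecMat x A +ᵛ (z2 ·ᵛ y))) ++ (vecMat x B +ᵛ (z2 ·ᵛ vecMat y D)))
    ≡⟨ act-⊕ idSP ν _ _ ⟩
  act idSP (x ++ (vecMat x A +ᵛ (z2 ·ᵛ y))) ++ act ν (vecMat x B +ᵛ (z2 ·ᵛ vecMat y D))
    ≡⟨ cong₂ _++_ (act-id _) (trans (act-+ ν _ _)
         (cong₂ _+ᵛ_ (act-vecMat ν x B) (trans (act-· ν z2 _) (cong (z2 ·ᵛ_) (act-vecMat ν y D))))) ⟩
  gword A (map (act ν) B) (map (act ν) D) x y ∎
  where open ≡-Reasoning

-- Take the first row of B with
-- an odd entry and negate the columns where that row has a 3; the row then
-- has entries in {0,1,2} and still an odd entry, the earlier (even) rows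
-- stay even, and D is unaffected since signs fix 2D.

Odd : ℤ₄ → Set
Odd a = a ≡ z1 ⊎ a ≡ z3

odd-not-even : ∀ {a} → Odd a → ¬ In02 a
odd-not-even (inj₁ refl) (inj₁ ())
odd-not-even (inj₁ refl) (inj₂ ())
odd-not-even (inj₂ refl) (inj₁ ())
odd-not-even (inj₂ refl) (inj₂ ())

oddEntry : (r : Word n) → (∃ λ j → Odd (lookup r j)) ⊎ (∀ j → In02 (lookup r j))
oddEntry [] = inj₂ λ ()
oddEntry (z1 ∷ r) = inj₁ (zero , inj₁ refl)
oddEntry (z3 ∷ r) = inj₁ (zero , inj₂ refl)
oddEntry (z0 ∷ r) = Sum.map (λ (j , o) → suc j , o) (λ e → λ { zero → inj₁ refl ; (suc j) → e j }) (oddEntry r)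
oddEntry (z2 ∷ r) = Sum.map (λ (j , o) → suc j , o) (λ e → λ { zero → inj₂ refl ; (suc j) → e j }) (oddEntry r)

firstOddRow : (B : Matrix k n) → (∀ i j → In02 (entry B i j)) ⊎
  (∃ λ i → (∀ (i' : Fin k) → i' <ᶠ i → ∀ j → In02 (entry B i' j)) × (∃ λ j → Odd (entry B i j)))
firstOddRow [] = inj₁ λ ()
firstOddRow (r ∷ B) with oddEntry r
... | inj₁ odd = inj₂ (zero , (λ _ ()) , odd)
... | inj₂ r-even with firstOddRow B
...   | inj₁ B-even = inj₁ λ { zero → r-even ; (suc i) → B-even i }
...   | inj₂ (i , before , odd) = inj₂ (suc i , earlier , odd)
  where
  earlier : ∀ i' → i' <ᶠ suc i → ∀ j → In02 (entry (r ∷ B) i' j)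
  earlier zero _ = r-even
  earlier (suc i') (s≤s lt) = before i' lt

signFor : ℤ₄ → ℤ₄
signFor z3 = z3
signFor z0 = z1
signFor z1 = z1
signFor z2 = z1

signFor-unit : ∀ a → Unit (signFor a)
signFor-unit z0 = inj₁ refl
signFor-unit z1 = inj₁ refl
signFor-unit z2 = inj₁ refl
signFor-unit z3 = inj₂ refl

signFor-012 : ∀ a → In012 (signFor a *₄ a)
signFor-012 z0 = inj₁ refl
signFor-012 z1 = inj₂ (inj₁ refl)
signFor-012 z2 = inj₂ (inj₂ refl)
signFor-012 z3 = inj₂ (inj₁ refl)

signFor-odd : ∀ {a} → Odd a → Odd (signFor a *₄ a)
signFor-odd (inj₁ refl) = inj₁ refl
signFor-odd (inj₂ refl) = inj₁ refl

signs-two : (sg : Fin n → ℤ₄) (sg-unit : ∀ j → Unit (sg j)) (w : Word n) → act (signs sg sg-unit) (z2 ·ᵛ w) ≡ z2 ·ᵛ w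
signs-two sg sg-unit w = vext λ j → trans (lookup-act (signs sg sg-unit) _ j)
  (trans (cong (sg j *₄_) (lookup-·ᵛ z2 w j)) (trans (unit-two (sg-unit j) (lookup w j)) (sym (lookup-·ᵛ z2 w j))))
  where
  unit-two : ∀ {u} → Unit u → ∀ a → u *₄ (z2 *₄ a) ≡ z2 *₄ a
  unit-two (inj₁ refl) = decide₁ (λ a → z1 *₄ (z2 *₄ a)) (z2 *₄_)
  unit-two (inj₂ refl) = decide₁ (λ a → z3 *₄ (z2 *₄ a)) (z2 *₄_)

normaliseB : ∀ {k₁ k₂ ℓ} (A : Matrix k₁ k₂) (B : Matrix k₁ ℓ) (D : Matrix k₂ ℓ) →
  Σ (SignedPerm (k₁ + k₂ + ℓ)) λ τ → Σ (Matrix k₁ ℓ) λ B' → InℬB B' × Carries τ (Span (GMat A B D)) (Span (GMat A B' D))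
normaliseB A B D with firstOddRow B
... | inj₁ B-even = idSP , B , inj₁ B-even , carries-id (λ _ p → p) (λ _ p → p)
... | inj₂ (i , before , (j₀ , odd)) =
  idSP ⊕ ν , B' , inj₂ (i , before' , (j₀ , odd' ) , row-012) , carries-GMat (idSP ⊕ ν) (λ x → x) (λ x → x) (λ _ → refl) on-gwords
  where
  sg : Fin _ → ℤ₄
  sg j = signFor (entry B i j)
  ν = signs sg (λ j → signFor-unit _)
  B' = map (act ν) B
  entry-B' : ∀ i' j → entry B' i' j ≡ sg j *₄ entry B i' j
  entry-B' = entry-map-act ν B
  before' : ∀ i' → i' <ᶠ i → ∀ j → In02 (entry B' i' j)
  before' i' lt j = subst In02 (sym (entry-B' i' j)) (in02-*ʳ (sg j) (before i' lt j))
  odd' : ¬ In02 (entry B' i j₀)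
  odd' p = odd-not-even (signFor-odd odd) (subst In02 (entry-B' i j₀) p)
  row-012 : ∀ j → In012 (entry B' i j)
  row-012 j = subst In012 (sym (entry-B' i j)) (signFor-012 (entry B i j))
  on-gwords : ∀ x y → act (idSP ⊕ ν) (gword A B D x y) ≡ gword A B' D x y
  on-gwords x y = trans (act-last ν A B D x y)
    (cong (λ t → (x ++ (vecMat x A +ᵛ (z2 ·ᵛ y))) ++ (vecMat x B' +ᵛ t)) (trans (cong (z2 ·ᵛ_) (sym (act-vecMat ν y D))) (trans (sym (act-· ν z2 _)) (signs-two sg _ _))))

-- Normalisation (iii): sort the columns of (B ; 2D), i.e. permute the last
-- ℓ coordinates.  This permutes the columns of B and D, which preserves
-- B ∈ 𝓑 and D being a (0,1)-matrix.

lookup-transpose : ∀ {a b} (M : Matrix a b) (j : Fin b) → lookup (transpose M) j ≡ column M j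
lookup-transpose {b = b} [] j = lookup-replicate j []
lookup-transpose {a = suc a} {b} (r ∷ M) j = begin
  lookup ((replicate b cons ⊛ r) ⊛ transpose M) j         ≡⟨ lookup-⊛ j (replicate b cons ⊛ r) (transpose M) ⟩
  lookup (replicate b cons ⊛ r) j (lookup (transpose M) j) ≡⟨ cong₂ (λ f t → f t) cons-lookup (lookup-transpose M j) ⟩
  lookup r j ∷ column M j                                  ∎
  where
  open ≡-Reasoning
  cons : ℤ₄ → Word a → Word (suc a)
  cons = _∷_
  cons-lookup : lookup (replicate b cons ⊛ r) j ≡ cons (lookup r j)
  cons-lookup = trans (lookup-⊛ j (replicate b cons) r) (cong (λ f → f (lookup r j)) (lookup-replicate j cons))

sortColumns : ∀ {k₁ k₂ ℓ} (A : Matrix k₁ k₂) (B : Matrix k₁ ℓ) (D : Matrix k₂ ℓ) → InℬB B → EntriesIn01 D →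
  Σ (SignedPerm (k₁ + k₂ + ℓ)) λ τ → Σ (Matrix k₁ ℓ) λ B' → Σ (Matrix k₂ ℓ) λ D' →
    InℬB B' × EntriesIn01 D' × ColSorted (stackB2D B' D') × Carries τ (Span (GMat A B D)) (Span (GMat A B' D'))
sortColumns {k₁} {k₂} {ℓ} A B D B-ℬ D-01 =
  idSP ⊕ ν , B' , D' , B'-ℬ B-ℬ , D'-01 , sorted , carries-GMat (idSP ⊕ ν) (λ x → x) (λ x → x) (λ _ → refl) (act-last ν A B D)
  where
  columns : Fin ℓ → Word (k₁ + k₂)
  columns = lookup (transpose (stackB2D B D))
  ρ = proj₁ (sort columns)
  ν = unsigned ρ
  B' = map (act ν) B
  D' = map (act ν) D
  permuted : ∀ {k} (M : Matrix k ℓ) i j → entry (map (act ν) M) i j ≡ entry M i (ρ ⟨$⟩ʳ j)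
  permuted M i j = trans (entry-map-act ν M i j) (*₄-identityˡ _)
  D'-01 : EntriesIn01 D'
  D'-01 i j = subst In01 (sym (permuted D i j)) (D-01 i (ρ ⟨$⟩ʳ j))
  B'-ℬ : InℬB B → InℬB B'
  B'-ℬ (inj₁ B-even) = inj₁ λ i j → subst In02 (sym (permuted B i j)) (B-even i _)
  B'-ℬ (inj₂ (i , before , (j₀ , odd) , row)) = inj₂ (i ,
    (λ i' lt j → subst In02 (sym (permuted B i' j)) (before i' lt _)) ,
    (ρ ⟨$⟩ˡ j₀ , λ p → odd (subst In02 (trans (permuted B i _) (cong (entry B i) (inverseʳ ρ))) p)) ,
    λ j → subst In012 (sym (permuted B i j)) (row _))
  stacked : stackB2D B' D' ≡ map (act ν) (stackB2D B D)
  stacked = trans (cong (B' ++_) (scale-act D)) (sym (map-++ (act ν) B (scaleMat z2 D)))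
    where
    scale-act : ∀ {k} (D : Matrix k ℓ) → scaleMat z2 (map (act ν) D) ≡ map (act ν) (scaleMat z2 D)
    scale-act [] = refl
    scale-act (d ∷ D) = cong₂ _∷_ (sym (act-· ν z2 d)) (scale-act D)
  column-permuted : ∀ j → lookup (transpose (stackB2D B' D')) j ≡ columns (ρ ⟨$⟩ʳ j)
  column-permuted j = begin
    lookup (transpose (stackB2D B' D')) j             ≡⟨ cong (λ M → lookup (transpose M) j) stacked ⟩
    lookup (transpose (map (act ν) (stackB2D B D))) j ≡⟨ lookup-transpose _ j ⟩
    column (map (act ν) (stackB2D B D)) j             ≡⟨ sym (map-∘ _ _ _) ⟩
    map (λ r → lookup (act ν r) j) (stackB2D B D)     ≡⟨ map-cong (λ r → lookup-unsigned ρ r j) _ ⟩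
    column (stackB2D B D) (ρ ⟨$⟩ʳ j)                  ≡⟨ sym (lookup-transpose _ _) ⟩
    columns (ρ ⟨$⟩ʳ j)                                ∎
    where open ≡-Reasoning
  sorted : ColSorted (stackB2D B' D')
  sorted i j le = subst₂ _≤ˡᵉˣ_ (sym (column-permuted i)) (sym (column-permuted j)) (proj₂ (sort columns) i j le)

∷ʳ0-init : (w : Word (suc m)) → lookup w (fromℕ m) ≡ z0 → w ≡ initᵛ w ∷ʳ z0
∷ʳ0-init {zero} (x ∷ []) refl = refl
∷ʳ0-init {suc m} (x ∷ y ∷ xs) e = cong (x ∷_) (∷ʳ0-init (y ∷ xs) e)

lastIsZero-sound : (w : Word (suc m)) → lastIsZero w ≡ true → lookup w (fromℕ m) ≡ z0
lastIsZero-sound {zero} (z0 ∷ []) _ = refl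
lastIsZero-sound {suc m} (z0 ∷ y ∷ xs) e = lastIsZero-sound (y ∷ xs) e
lastIsZero-sound {suc m} (z1 ∷ y ∷ xs) e = lastIsZero-sound (y ∷ xs) e
lastIsZero-sound {suc m} (z2 ∷ y ∷ xs) e = lastIsZero-sound (y ∷ xs) e
lastIsZero-sound {suc m} (z3 ∷ y ∷ xs) e = lastIsZero-sound (y ∷ xs) e

lastIsZero-complete : (w : Word (suc m)) → lookup w (fromℕ m) ≡ z0 → lastIsZero w ≡ true
lastIsZero-complete {zero} (z0 ∷ []) _ = refl
lastIsZero-complete {suc m} (z0 ∷ y ∷ xs) e = lastIsZero-complete (y ∷ xs) e
lastIsZero-complete {suc m} (z1 ∷ y ∷ xs) e = lastIsZero-complete (y ∷ xs) e
lastIsZero-complete {suc m} (z2 ∷ y ∷ xs) e = lastIsZero-complete (y ∷ xs) e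
lastIsZero-complete {suc m} (z3 ∷ y ∷ xs) e = lastIsZero-complete (y ∷ xs) e

initᵛ-∷ʳ0 : (e : Word m) → initᵛ (e ∷ʳ z0) ≡ e
initᵛ-∷ʳ0 [] = refl
initᵛ-∷ʳ0 (x ∷ []) = refl
initᵛ-∷ʳ0 (x ∷ y ∷ e) = cong (x ∷_) (initᵛ-∷ʳ0 (y ∷ e))

initᵛ-+ᵛ : (u v : Word (suc m)) → initᵛ (u +ᵛ v) ≡ initᵛ u +ᵛ initᵛ v
initᵛ-+ᵛ {zero} (x ∷ []) (y ∷ []) = refl
initᵛ-+ᵛ {suc m} (x ∷ x' ∷ u) (y ∷ y' ∷ v) = cong (x +₄ y ∷_) (initᵛ-+ᵛ (x' ∷ u) (y' ∷ v))

∷ʳ0-+ᵛ : (u v : Word m) → (u ∷ʳ z0) +ᵛ (v ∷ʳ z0) ≡ (u +ᵛ v) ∷ʳ z0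
∷ʳ0-+ᵛ [] [] = refl
∷ʳ0-+ᵛ (x ∷ u) (y ∷ v) = cong (x +₄ y ∷_) (∷ʳ0-+ᵛ u v)

∷ʳ0-·ᵛ : (c : ℤ₄) (u : Word m) → c ·ᵛ (u ∷ʳ z0) ≡ (c ·ᵛ u) ∷ʳ z0
∷ʳ0-·ᵛ c [] = cong (_∷ []) (*₄-zeroʳ c)
∷ʳ0-·ᵛ c (x ∷ u) = cong (c *₄ x ∷_) (∷ʳ0-·ᵛ c u)

0ᵛ∷ʳ0 : ∀ m → 0ᵛ {m} ∷ʳ z0 ≡ 0ᵛ {suc m}
0ᵛ∷ʳ0 zero = refl
0ᵛ∷ʳ0 (suc m) = cong (z0 ∷_) (0ᵛ∷ʳ0 m)

∧ᵇ-elim : ∀ {a b} → (a ∧ᵇ b) ≡ true → a ≡ true × b ≡ true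
∧ᵇ-elim {true} {true} _ = refl , refl

-- Shortening.  If σ maps every codeword of C to a word ending in 0, then C
-- is equivalent (via σ) to the trivial extension of the code
-- E = {e | σ⁻¹ (e, 0) ∈ C}, which has the same type as C.
shorten : ∀ {k₁ k₂} (C : Code (suc m)) → IsCode C → HasType C k₁ k₂ → (σ : SignedPerm (suc m)) →
  (∀ w → w ∈ᶜ C → lookup (act σ w) (fromℕ m) ≡ z0) →
  Σ (Code m) λ E → IsCode E × HasType E k₁ k₂ × Equivalent C (TrivialExtension E)
shorten {m} {k₁} {k₂} C (C0 , C+ , C·) (φ , φ-additive , φ-injective , φ-into , φ-onto) σ last-zero =
  E , E-code , E-type , equivalent
  where
  σ⁻¹ = inv σ
  E : Code m
  E e = C (act σ⁻¹ (e ∷ʳ z0))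
  E-code : IsCode E
  E-code = subst (_≡ true) (cong C (sym (trans (cong (act σ⁻¹) (0ᵛ∷ʳ0 m)) (act-0ᵛ σ⁻¹)))) C0 ,
    (λ u v pu pv → subst (_≡ true) (cong C (trans (sym (act-+ σ⁻¹ _ _)) (cong (act σ⁻¹) (∷ʳ0-+ᵛ u v)))) (C+ _ _ pu pv)) ,
    (λ c u pu → subst (_≡ true) (cong C (trans (sym (act-· σ⁻¹ c _)) (cong (act σ⁻¹) (∷ʳ0-·ᵛ c u)))) (C· c _ pu))
  φE : Vec ℤ₄ k₁ × Vec ℤ₂ k₂ → Word m
  φE x = initᵛ (act σ (φ x))
  σφ≡ : ∀ x → act σ (φ x) ≡ φE x ∷ʳ z0
  σφ≡ x = ∷ʳ0-init _ (last-zero (φ x) (φ-into x))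
  E-type : HasType E k₁ k₂
  E-type = φE ,
    (λ x₁ x₂ y₁ y₂ → trans (cong (λ t → initᵛ (act σ t)) (φ-additive x₁ x₂ y₁ y₂)) (trans (cong initᵛ (act-+ σ _ _)) (initᵛ-+ᵛ _ _))) ,
    (λ x y e → φ-injective x y (trans (sym (act-inv-act σ (φ x)))
      (trans (cong (act σ⁻¹) (trans (σφ≡ x) (trans (cong (_∷ʳ z0) e) (sym (σφ≡ y))))) (act-inv-act σ (φ y))))) ,
    (λ x → subst (_≡ true) (cong C (trans (sym (act-inv-act σ (φ x))) (cong (act σ⁻¹) (σφ≡ x)))) (φ-into x)) ,
    (λ e p → let (x , ex) = φ-onto _ p in x , trans (cong initᵛ (trans (cong (act σ) ex) (act-act-inv σ _))) (initᵛ-∷ʳ0 e))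
  equivalent : Equivalent C (TrivialExtension E)
  equivalent = PM σ , PM-signedMonomial σ , λ w → into w , onto w
    where
    into : ∀ w → w ∈ᶜ TrivialExtension E → ∃ λ v → v ∈ᶜ C × w ≡ vecMat v (PM σ)
    into w p with ∧ᵇ-elim {lastIsZero w} p
    ... | w-last , w-init = act σ⁻¹ w ,
      subst (_≡ true) (cong (λ t → C (act σ⁻¹ t)) (sym (∷ʳ0-init w (lastIsZero-sound w w-last)))) w-init ,
      trans (sym (act-act-inv σ w)) (sym (vecMat-PM σ _))
    onto : ∀ w → (∃ λ v → v ∈ᶜ C × w ≡ vecMat v (PM σ)) → w ∈ᶜ TrivialExtension E
    onto w (v , v∈C , w≡) = subst (λ b → (b ∧ᵇ E (initᵛ w)) ≡ true) (sym (lastIsZero-complete w w-last)) init∈E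
      where
      w≡σv : w ≡ act σ v
      w≡σv = trans w≡ (vecMat-PM σ v)
      w-last : lookup w (fromℕ m) ≡ z0
      w-last = trans (cong (λ t → lookup t (fromℕ m)) w≡σv) (last-zero v v∈C)
      init∈E : E (initᵛ w) ≡ true
      init∈E = subst (_≡ true) (cong C (trans (sym (act-inv-act σ v)) (cong (act σ⁻¹) (trans (sym w≡σv) (∷ʳ0-init w w-last))))) v∈C

-- A coordinate q that vanishes on σ C can be moved to the end, so C is then
-- equivalent to a trivial extension.
zeroCoordinate : ∀ {k₁ k₂} (C : Code n) → IsCode C → HasType C k₁ k₂ → (σ : SignedPerm n) (q : Fin n) →
  (∀ w → w ∈ᶜ C → lookup (act σ w) q ≡ z0) →
  Σ (Code (pred n)) λ E → IsCode E × HasType E k₁ k₂ × Equivalent C (TrivialExtension E)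
zeroCoordinate {suc m} C C-code C-type σ q q-zero = shorten C C-code C-type (σ ⨾ unsigned swap) last-zero
  where
  swap = P.transpose (fromℕ m) q
  last-zero : ∀ w → w ∈ᶜ C → lookup (act (σ ⨾ unsigned swap) w) (fromℕ m) ≡ z0
  last-zero w w∈C = begin
    lookup (act (σ ⨾ unsigned swap) w) (fromℕ m)   ≡⟨ cong (λ t → lookup t (fromℕ m)) (act-⨾ σ (unsigned swap) w) ⟩
    lookup (act (unsigned swap) (act σ w)) (fromℕ m) ≡⟨ lookup-unsigned swap (act σ w) (fromℕ m) ⟩
    lookup (act σ w) (swap ⟨$⟩ʳ fromℕ m)           ≡⟨ cong (lookup (act σ w)) (transpose-first (fromℕ m) q) ⟩
    lookup (act σ w) q                             ≡⟨ q-zero w w∈C ⟩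
    z0                                             ∎
    where
    open ≡-Reasoning
    transpose-first : ∀ {n} (i j : Fin n) → PC.transpose i j i ≡ j
    transpose-first i j rewrite dec-true (i ≟ᶠ i) refl = refl

record InVForm (k₁ k₂ ℓ : ℕ) (M : Matrix (k₁ + k₂) (k₁ + k₂ + ℓ)) : Set where
  field
    σ : SignedPerm (k₁ + k₂ + ℓ)
    A : Matrix k₁ k₂
    B : Matrix k₁ ℓ
    D : Matrix k₂ ℓ
    inV : InV A B D
    carries : Carries σ (Span M) (Span (GMat A B D))

normalise : ∀ {k₁ k₂ ℓ} {M : Matrix (k₁ + k₂) (k₁ + k₂ + ℓ)} → StandardForm k₁ k₂ ℓ M → InVForm k₁ k₂ ℓ M
normalise F
  with sortRowsOfA (StandardForm.A F) (StandardForm.B F) (StandardForm.D F) (StandardForm.A-01 F)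
... | τ₁ , A , B₁ , A-01 , A-sorted , carries₁
  with normaliseB A B₁ (StandardForm.D F)
... | τ₂ , B₂ , B₂-ℬ , carries₂
  with sortColumns A B₂ (StandardForm.D F) B₂-ℬ (StandardForm.D-01 F)
... | τ₃ , B , D , B-ℬ , D-01 , columns-sorted , carries₃ = record
  { σ = ((StandardForm.σ F ⨾ τ₁) ⨾ τ₂) ⨾ τ₃ ; A = A ; B = B ; D = D
  ; inV = (A-01 , A-sorted) , B-ℬ , (D-01 , columns-sorted)
  ; carries = carries-⨾ (carries-⨾ (carries-⨾ (StandardForm.carries F) carries₁) carries₂) carries₃
  }

transport-generatedBy : ∀ {k k'} (C : Code n) (M : Matrix k n) (G : Matrix k' n) (σ : SignedPerm n) →
  (∀ w → w ∈ᶜ C → Span M w) → (∀ w → Span M w → w ∈ᶜ C) → Carries σ (Span M) (Span G) →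
  GeneratedBy (transport σ C) G
transport-generatedBy C M G σ spans within (σ→ , σ←) w =
  (λ p → subst (Span G) (act-act-inv σ w) (σ→ _ (spans _ p))) ,
  (λ p → within _ (σ← w p))

-- The coordinate k₁ + k₂ + j of every codeword of G(A,B,D) is the
-- combination x·(column j of B) + y·(column j of 2D); it vanishes when
-- that column of (B ; 2D) is zero.
gword-zeroColumn : ∀ {k₁ k₂ ℓ} (A : Matrix k₁ k₂) (B : Matrix k₁ ℓ) (D : Matrix k₂ ℓ) (j : Fin ℓ) →
  lookup (transpose (stackB2D B D)) j ≡ 0ᵛ → ∀ x y → lookup (gword A B D x y) ((k₁ + k₂) ↑ʳ j) ≡ z0
gword-zeroColumn {k₁} {k₂} A B D j zero-column x y = begin
  lookup (gword A B D x y) ((k₁ + k₂) ↑ʳ j)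
    ≡⟨ lookup-++ʳ (x ++ (vecMat x A +ᵛ (z2 ·ᵛ y))) (vecMat x B +ᵛ (z2 ·ᵛ vecMat y D)) j ⟩
  lookup (vecMat x B +ᵛ (z2 ·ᵛ vecMat y D)) j
    ≡⟨ cong (λ t → lookup (vecMat x B +ᵛ t) j) (sym (vecMat-scaleMat y z2 D)) ⟩
  lookup (vecMat x B +ᵛ vecMat y (scaleMat z2 D)) j
    ≡⟨ lookup-+ᵛ (vecMat x B) _ j ⟩
  lookup (vecMat x B) j +₄ lookup (vecMat y (scaleMat z2 D)) j
    ≡⟨ cong₂ _+₄_ (lookup-vecMat x B j) (lookup-vecMat y (scaleMat z2 D) j) ⟩
  dot x (column B j) +₄ dot y (column (scaleMat z2 D) j)
    ≡⟨ cong₂ _+₄_ (trans (cong (dot x) (proj₁ halves)) (dot-zeroʳ x)) (trans (cong (dot y) (proj₂ halves)) (dot-zeroʳ y)) ⟩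
  z0 ∎
  where
  open ≡-Reasoning
  halves : column B j ≡ 0ᵛ × column (scaleMat z2 D) j ≡ 0ᵛ
  halves = ++-0ᵛ⁻¹ _ _ (trans (sym (map-++ (λ r → lookup r j) B (scaleMat z2 D)))
                              (trans (sym (lookup-transpose (stackB2D B D) j)) zero-column))

zeroColumn-trivial : ∀ {k₁ k₂ ℓ} (C : Code (k₁ + k₂ + ℓ)) → IsCode C → HasType C k₁ k₂ →
  (σ : SignedPerm (k₁ + k₂ + ℓ)) (A : Matrix k₁ k₂) (B : Matrix k₁ ℓ) (D : Matrix k₂ ℓ) →
  (∀ w → w ∈ᶜ C → Span (GMat A B D) (act σ w)) → (j : Fin ℓ) → lookup (transpose (stackB2D B D)) j ≡ 0ᵛ →
  Σ (Code (pred (k₁ + k₂ + ℓ))) λ E → IsCode E × HasType E k₁ k₂ × Equivalent C (TrivialExtension E)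
zeroColumn-trivial {k₁} {k₂} C C-code C-type σ A B D into j zero-column =
  zeroCoordinate C C-code C-type σ ((k₁ + k₂) ↑ʳ j) vanishes
  where
  vanishes : ∀ w → w ∈ᶜ C → lookup (act σ w) ((k₁ + k₂) ↑ʳ j) ≡ z0
  vanishes w w∈C with span-GMat A B D (into w w∈C)
  ... | x , y , σw≡ = trans (cong (λ t → lookup t ((k₁ + k₂) ↑ʳ j)) σw≡) (gword-zeroColumn A B D j zero-column x y)

conclusion : ∀ {k₁ k₂ ℓ} (C : Code (k₁ + k₂ + ℓ)) → IsCode C → HasType C k₁ k₂ →
    (∀ (E : Code (pred (k₁ + k₂ + ℓ))) → IsCode E → HasType E k₁ k₂ → ¬ Equivalent C (TrivialExtension E)) →
    (basis : Basis C k₁ k₂) → InVForm k₁ k₂ ℓ (Basis.gs basis ++ Basis.hs basis) →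
    Σ (Code (k₁ + k₂ + ℓ)) λ C' → IsCode C' × HasType C' k₁ k₂ × Equivalent C C' ×
      Σ (Matrix k₁ k₂) λ A → Σ (Matrix k₁ ℓ) λ B → Σ (Matrix k₂ ℓ) λ D →
        InV A B D × GeneratedBy C' (GMat A B D) × NoZeroColumn (stackB2D B D)
conclusion C C-code C-type nontrivial basis form =
  transport σ C , transport-isCode σ C C-code , transport-hasType σ C C-type , transport-equivalent σ C ,
  A , B , D , inV , transport-generatedBy C (gs ++ hs) (GMat A B D) σ spans within carries , no-zero-column
  where
  open Basis basis
  open InVForm form
  no-zero-column : NoZeroColumn (stackB2D B D)
  no-zero-column j zero-column
    with zeroColumn-trivial C C-code C-type σ A B D (λ w w∈C → proj₁ carries w (spans w w∈C)) j zero-column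
  ... | E , E-code , E-type , equivalent = nontrivial E E-code E-type equivalent

proposition5p4 : (k₁ k₂ ℓ : ℕ) → 1 ≤ k₁ + k₂ + ℓ →
    (C : Code (k₁ + k₂ + ℓ)) → IsCode C → HasType C k₁ k₂ →
    (∀ (E : Code (pred (k₁ + k₂ + ℓ))) → IsCode E → HasType E k₁ k₂ →
      ¬ Equivalent C (TrivialExtension E)) →
    Σ (Code (k₁ + k₂ + ℓ)) λ C' → IsCode C' × HasType C' k₁ k₂ × Equivalent C C' ×
      Σ (Matrix k₁ k₂) λ A → Σ (Matrix k₁ ℓ) λ B → Σ (Matrix k₂ ℓ) λ D →
        InV A B D × GeneratedBy C' (GMat A B D) × NoZeroColumn (stackB2D B D)
proposition5p4 k₁ k₂ ℓ _ C C-code C-type nontrivial =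
  conclusion C C-code C-type nontrivial C-basis (normalise (standardForm k₁ k₂ ℓ gs hs hs-even independent))
  where
  C-basis = basis C C-type
  open Basis C-basis
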